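{- Let $m,n$ be coprime positive integers and $k\ge1$. Then for every partition $\lambda\vdash kn$, $$\frac{[k]_q}{[km]_q}\,s_\lambda\big[[km]_q\big]\in\mathbb{Q}[q],$$ where $s_\lambda[[km]_q]=s_\lambda(1,q,q^2,\dots,q^{km-1})$.
   Context: $[s]_q=1+q+\cdots+q^{s-1}$ for integers $s\ge0$; $s_\lambda$ is the Schur function indexed by $\lambda$. -}

module Defs where

open import Data.Nat using (ℕ; zero; suc; _+_; _∸_; _<ᵇ_; _≤_)
open import Data.Bool using (Bool; true; false; _∧_)
open import Data.List using (List; []; _∷_; _++_; map; concatMap; filterᵇ; upTo; replicate; foldr)
open import Data.Nat.ListAction using (sum)
open import Data.Rational using (ℚ; 0ℚ; 1ℚ) renaming (_+_ to _+ℚ_; _*_ to _*ℚ_)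
open import Relation.Binary.PropositionalEquality using (_≡_)

-- Polynomials in q with rational coefficients, as coefficient lists
-- (index i = coefficient of q^i), compared coefficientwise.

Poly : Set
Poly = List ℚ

coeff : Poly → ℕ → ℚ
coeff []       _       = 0ℚ
coeff (a ∷ p)  zero    = a
coeff (a ∷ p)  (suc i) = coeff p i

_≈ₚ_ : Poly → Poly → Set
p ≈ₚ r = ∀ i → coeff p i ≡ coeff r i

infixl 6 _+ₚ_
infixl 7 _*ₚ_

_+ₚ_ : Poly → Poly → Poly
[]      +ₚ r       = r
(a ∷ p) +ₚ []      = a ∷ p
(a ∷ p) +ₚ (b ∷ r) = (a +ℚ b) ∷ (p +ₚ r)

_*ₚ_ : Poly → Poly → Poly
[]      *ₚ r = []
(a ∷ p) *ₚ r = map (a *ℚ_) r +ₚ (0ℚ ∷ (p *ₚ r))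

monomial : ℕ → Poly
monomial d = replicate d 0ℚ ++ (1ℚ ∷ [])

qint : ℕ → Poly
qint s = replicate s 1ℚ

data IsPartition : List ℕ → Set where
  []  : IsPartition []
  one : ∀ {a} → 1 ≤ a → IsPartition (a ∷ [])
  two : ∀ {a b ls} → b ≤ a → IsPartition (b ∷ ls) → IsPartition (a ∷ b ∷ ls)

-- Semistandard Young tableaux with entries in {0,...,N-1}
-- (entry i stands for the variable x_{i+1}), listed row by row.

range : ℕ → ℕ → List ℕ
range lo N = map (lo +_) (upTo (N ∸ lo))

incRows : ℕ → ℕ → ℕ → List (List ℕ)
incRows N zero    lo = [] ∷ []
incRows N (suc l) lo = concatMap (λ a → map (a ∷_) (incRows N l a)) (range lo N)

strictlyBelow : List ℕ → List ℕ → Bool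
strictlyBelow _        []       = true
strictlyBelow []       (_ ∷ _)  = false
strictlyBelow (a ∷ as) (b ∷ bs) = (a <ᵇ b) ∧ strictlyBelow as bs

compatible : List ℕ → List (List ℕ) → Bool
compatible r []        = true
compatible r (r' ∷ _)  = strictlyBelow r r'

ssyt : ℕ → List ℕ → List (List (List ℕ))
ssyt N []       = [] ∷ []
ssyt N (l ∷ ls) =
  concatMap (λ r → map (r ∷_) (filterᵇ (compatible r) (ssyt N ls))) (incRows N l 0)

-- sum of entries; x^T specialised at x_{i+1} = q^i is q^(weight T)
weight : List (List ℕ) → ℕ
weight T = sum (map sum T)

schurPS : ℕ → List ℕ → Poly
schurPS N sh = foldr (λ T acc → monomial (weight T) +ₚ acc) [] (ssyt N sh)

-- Put N = km and D = |λ| = kn. Composing the Bender–Knuth involutions BK₀, …, BK_(N-2) gives a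
-- permutation σ (promotion) of the semistandard tableaux with entries < N that rotates their content,
-- so that wt T + N·c₀(T) = wt(σT) + D, where c₀(T) is the number of entries 0. Summing
-- [wt σT]_q + q^(wt σT) [D]_q = [wt T]_q + q^(wt T) [N c₀(T)]_q over all T shows that [N]_q divides
-- [D]_q · s_λ[[N]_q]. As m and n are coprime, uD ≡ k (mod N) for some u, so [N]_q divides
-- [uD]_q − [k]_q, while [D]_q divides [uD]_q; hence [N]_q divides [k]_q · s_λ[[N]_q].

module Submission where

open import Defs
open import Algebra.Bundles using (CommutativeMonoid)
open import Data.Bool using (T)
open import Data.Bool.Properties using (T-∧)
open import Data.List using (List; []; _∷_; _++_; map; replicate; foldr; length; drop; filter; concatMap; filterᵇ)
import Data.List.Properties as List
open import Data.List.Properties using (filter-accept; filter-reject; filter-none; filter-++; filter-idem; ++-identityʳ)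
open import Data.List.Membership.Propositional using (_∈_)
open import Data.List.Membership.Propositional.Properties
  using (∈-map⁺; ∈-map⁻; ∈-++⁺ˡ; ∈-++⁺ʳ; ∈-++⁻; ∈-upTo⁺; ∈-upTo⁻; ∈-filter⁺; ∈-filter⁻)
open import Data.List.Membership.Propositional.Properties.WithK using (unique∧set⇒bag)
import Data.List.Membership.DecPropositional as DecMembership
open import Data.List.Relation.Binary.BagAndSetEquality using (∼bag⇒↭)
open import Data.List.Relation.Binary.Permutation.Propositional as ↭ using (_↭_)
open import Data.List.Relation.Unary.All as All using (All; []; _∷_)
open import Data.List.Relation.Unary.All.Properties using (all-filter; replicate⁺; ++⁺)
open import Data.List.Relation.Unary.AllPairs using ([]; _∷_)
open import Data.List.Relation.Unary.Any using (here; there)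
open import Data.List.Relation.Unary.Unique.Propositional using (Unique)
import Data.List.Relation.Unary.Unique.Propositional.Properties as Unique
open import Data.Nat using (ℕ; zero; suc; _+_; _*_; _∸_; _≤_; _<_; _<?_; _≤?_; _≟_; z≤n; s≤s; z<s; _⊔_; _⊓_)
open import Data.Nat.Properties
open import Data.Nat.Coprimality using (Coprime; coprime-Bézout)
open import Data.Nat.GCD using (module Bézout)
open import Data.Nat.ListAction using (sum)
open import Data.Nat.Solver using (module +-*-Solver)
open +-*-Solver using (solve; _:+_; _:*_; _:=_; con)
open import Data.Product using (∃; ∃₂; _×_; _,_; proj₁; proj₂)
open import Data.Rational using (ℚ; 0ℚ; 1ℚ; -_) renaming (_+_ to _+ℚ_; _*_ to _*ℚ_)
import Data.Rational.Properties as ℚ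
open import Algebra.Properties.Group ℚ.+-0-group using (∙-cancelˡ)
open import Algebra.Properties.Ring ℚ.+-*-ring using (-‿distribʳ-*)
open import Algebra.Properties.CommutativeSemigroup
  (CommutativeMonoid.commutativeSemigroup ℚ.+-0-commutativeMonoid) using (interchange)
open import Data.Sum using (inj₁; inj₂)
open import Function using (_∘_)
open import Function.Bundles using (Equivalence; mk⇔)
open import Relation.Binary.Bundles using (Setoid)
open import Relation.Binary.Definitions using (DecidableEquality; tri<; tri≈; tri>)
open import Relation.Binary.PropositionalEquality
import Relation.Binary.Reasoning.Setoid as SetoidReasoning
open import Relation.Nullary using (Dec; yes; no; ¬_)
open import Relation.Nullary.Decidable using (T?)
open import Relation.Nullary.Negation using (contradiction)

-- Polynomials as coefficient lists

-- Coefficientwise equality, wrapped in a record so that both polynomials can be inferred.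
infix 4 _≋_
record _≋_ (p r : Poly) : Set where
  constructor mk≋
  field coeff-≡ : ∀ i → coeff p i ≡ coeff r i
open _≋_ public

≋-refl : ∀ {p} → p ≋ p
≋-refl = mk≋ λ _ → refl

≋-sym : ∀ {p r} → p ≋ r → r ≋ p
≋-sym e = mk≋ λ i → sym (coeff-≡ e i)

≋-trans : ∀ {p r s} → p ≋ r → r ≋ s → p ≋ s
≋-trans e f = mk≋ λ i → trans (coeff-≡ e i) (coeff-≡ f i)

≋-reflexive : ∀ {p r} → p ≡ r → p ≋ r
≋-reflexive refl = ≋-refl

≋-setoid : Setoid _ _
≋-setoid = record
  { Carrier = Poly ; _≈_ = _≋_
  ; isEquivalence = record { refl = ≋-refl ; sym = ≋-sym ; trans = ≋-trans } }

module ≋-Reasoning = SetoidReasoning ≋-setoid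

∷-cong : ∀ {a p r} → p ≋ r → a ∷ p ≋ a ∷ r
∷-cong e = mk≋ λ { zero → refl ; (suc i) → coeff-≡ e i }

coeff-+ₚ : ∀ p r i → coeff (p +ₚ r) i ≡ coeff p i +ℚ coeff r i
coeff-+ₚ []      r       i       = sym (ℚ.+-identityˡ _)
coeff-+ₚ (a ∷ p) []      i       = sym (ℚ.+-identityʳ _)
coeff-+ₚ (a ∷ p) (b ∷ r) zero    = refl
coeff-+ₚ (a ∷ p) (b ∷ r) (suc i) = coeff-+ₚ p r i

+ₚ-lift : ∀ {p r s t} → (∀ i → coeff p i +ℚ coeff r i ≡ coeff s i +ℚ coeff t i) → p +ₚ r ≋ s +ₚ t
+ₚ-lift {p} {r} {s} {t} e =
  mk≋ λ i → trans (coeff-+ₚ p r i) (trans (e i) (sym (coeff-+ₚ s t i)))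

+ₚ-cong : ∀ {p p′ r r′} → p ≋ p′ → r ≋ r′ → p +ₚ r ≋ p′ +ₚ r′
+ₚ-cong {p} {p′} {r} {r′} e f = +ₚ-lift {p} {r} {p′} {r′} λ i → cong₂ _+ℚ_ (coeff-≡ e i) (coeff-≡ f i)

+ₚ-congˡ : ∀ {p r r′} → r ≋ r′ → p +ₚ r ≋ p +ₚ r′
+ₚ-congˡ = +ₚ-cong ≋-refl

+ₚ-comm : ∀ p r → p +ₚ r ≋ r +ₚ p
+ₚ-comm p r = +ₚ-lift {p} {r} {r} {p} λ i → ℚ.+-comm (coeff p i) (coeff r i)

+ₚ-identityʳ : ∀ p → p +ₚ [] ≋ p
+ₚ-identityʳ []      = ≋-refl
+ₚ-identityʳ (_ ∷ _) = ≋-refl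

+ₚ-assoc : ∀ p r s → (p +ₚ r) +ₚ s ≋ p +ₚ (r +ₚ s)
+ₚ-assoc p r s = mk≋ λ i → begin
  coeff ((p +ₚ r) +ₚ s) i                ≡⟨ coeff-+ₚ (p +ₚ r) s i ⟩
  coeff (p +ₚ r) i +ℚ coeff s i          ≡⟨ cong (_+ℚ coeff s i) (coeff-+ₚ p r i) ⟩
  (coeff p i +ℚ coeff r i) +ℚ coeff s i  ≡⟨ ℚ.+-assoc (coeff p i) (coeff r i) (coeff s i) ⟩
  coeff p i +ℚ (coeff r i +ℚ coeff s i)  ≡⟨ cong (coeff p i +ℚ_) (coeff-+ₚ r s i) ⟨
  coeff p i +ℚ coeff (r +ₚ s) i          ≡⟨ coeff-+ₚ p (r +ₚ s) i ⟨
  coeff (p +ₚ (r +ₚ s)) i                ∎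
  where open ≡-Reasoning

+ₚ-interchange : ∀ p r s t → (p +ₚ r) +ₚ (s +ₚ t) ≋ (p +ₚ s) +ₚ (r +ₚ t)
+ₚ-interchange p r s t = mk≋ λ i → begin
  coeff ((p +ₚ r) +ₚ (s +ₚ t)) i
    ≡⟨ coeff-+ₚ (p +ₚ r) (s +ₚ t) i ⟩
  coeff (p +ₚ r) i +ℚ coeff (s +ₚ t) i
    ≡⟨ cong₂ _+ℚ_ (coeff-+ₚ p r i) (coeff-+ₚ s t i) ⟩
  (coeff p i +ℚ coeff r i) +ℚ (coeff s i +ℚ coeff t i)
    ≡⟨ interchange (coeff p i) (coeff r i) (coeff s i) (coeff t i) ⟩
  (coeff p i +ℚ coeff s i) +ℚ (coeff r i +ℚ coeff t i)
    ≡⟨ cong₂ _+ℚ_ (coeff-+ₚ p s i) (coeff-+ₚ r t i) ⟨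
  coeff (p +ₚ s) i +ℚ coeff (r +ₚ t) i
    ≡⟨ coeff-+ₚ (p +ₚ s) (r +ₚ t) i ⟨
  coeff ((p +ₚ s) +ₚ (r +ₚ t)) i
    ∎
  where open ≡-Reasoning

+ₚ-cancelˡ : ∀ p {r s} → p +ₚ r ≋ p +ₚ s → r ≋ s
+ₚ-cancelˡ p {r} {s} e = mk≋ λ i → ∙-cancelˡ (coeff p i) (coeff r i) (coeff s i)
  (trans (sym (coeff-+ₚ p r i)) (trans (coeff-≡ e i) (coeff-+ₚ p s i)))

negₚ : Poly → Poly
negₚ = map -_

coeff-negₚ : ∀ p i → coeff (negₚ p) i ≡ - coeff p i
coeff-negₚ []      i       = refl
coeff-negₚ (a ∷ p) zero    = refl
coeff-negₚ (a ∷ p) (suc i) = coeff-negₚ p i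

negₚ-cong : ∀ {p r} → p ≋ r → negₚ p ≋ negₚ r
negₚ-cong {p} {r} e = mk≋ λ i →
  trans (coeff-negₚ p i) (trans (cong -_ (coeff-≡ e i)) (sym (coeff-negₚ r i)))

+ₚ-inverseʳ : ∀ p → p +ₚ negₚ p ≋ []
+ₚ-inverseʳ p = mk≋ λ i → trans (coeff-+ₚ p (negₚ p) i)
  (trans (cong (coeff p i +ℚ_) (coeff-negₚ p i)) (ℚ.+-inverseʳ (coeff p i)))

negₚ-+ₚ : ∀ p r → negₚ (p +ₚ r) ≋ negₚ p +ₚ negₚ r
negₚ-+ₚ p r = mk≋ λ i → begin
  coeff (negₚ (p +ₚ r)) i              ≡⟨ coeff-negₚ (p +ₚ r) i ⟩
  - coeff (p +ₚ r) i                   ≡⟨ cong -_ (coeff-+ₚ p r i) ⟩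
  - (coeff p i +ℚ coeff r i)           ≡⟨ ℚ.neg-distrib-+ (coeff p i) (coeff r i) ⟩
  - coeff p i +ℚ - coeff r i           ≡⟨ cong₂ _+ℚ_ (coeff-negₚ p i) (coeff-negₚ r i) ⟨
  coeff (negₚ p) i +ℚ coeff (negₚ r) i ≡⟨ coeff-+ₚ (negₚ p) (negₚ r) i ⟨
  coeff (negₚ p +ₚ negₚ r) i           ∎
  where open ≡-Reasoning

shift : ℕ → Poly → Poly
shift a p = replicate a 0ℚ ++ p

shift-cong : ∀ a {p r} → p ≋ r → shift a p ≋ shift a r
shift-cong zero    e = e
shift-cong (suc a) e = ∷-cong (shift-cong a e)

shift-+ₚ : ∀ a p r → shift a (p +ₚ r) ≋ shift a p +ₚ shift a r
shift-+ₚ zero    p r = ≋-refl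
shift-+ₚ (suc a) p r = mk≋ λ
  { zero    → sym (ℚ.+-identityˡ 0ℚ)
  ; (suc i) → coeff-≡ (shift-+ₚ a p r) i }

shift-[] : ∀ a → shift a [] ≋ []
shift-[] zero    = ≋-refl
shift-[] (suc a) = mk≋ λ { zero → refl ; (suc i) → coeff-≡ (shift-[] a) i }

shift-shift : ∀ a b p → shift a (shift b p) ≡ shift (a + b) p
shift-shift zero    b p = refl
shift-shift (suc a) b p = cong (0ℚ ∷_) (shift-shift a b p)

shift-comm : ∀ a b p → shift a (shift b p) ≡ shift b (shift a p)
shift-comm a b p = trans (shift-shift a b p)
  (trans (cong (λ c → shift c p) (+-comm a b)) (sym (shift-shift b a p)))

scale : ℚ → Poly → Poly
scale a = map (a *ℚ_)

coeff-scale : ∀ a p i → coeff (scale a p) i ≡ a *ℚ coeff p i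
coeff-scale a []      i       = sym (ℚ.*-zeroʳ a)
coeff-scale a (x ∷ p) zero    = refl
coeff-scale a (x ∷ p) (suc i) = coeff-scale a p i

scale-lift : ∀ a {p r} → (∀ i → a *ℚ coeff p i ≡ coeff r i) → scale a p ≋ r
scale-lift a {p} e = mk≋ λ i → trans (coeff-scale a p i) (e i)

scale-+ₚ : ∀ a p r → scale a (p +ₚ r) ≋ scale a p +ₚ scale a r
scale-+ₚ a p r = scale-lift a λ i → begin
  a *ℚ coeff (p +ₚ r) i                    ≡⟨ cong (a *ℚ_) (coeff-+ₚ p r i) ⟩
  a *ℚ (coeff p i +ℚ coeff r i)            ≡⟨ ℚ.*-distribˡ-+ a (coeff p i) (coeff r i) ⟩
  a *ℚ coeff p i +ℚ a *ℚ coeff r i         ≡⟨ cong₂ _+ℚ_ (coeff-scale a p i) (coeff-scale a r i) ⟨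
  coeff (scale a p) i +ℚ coeff (scale a r) i ≡⟨ coeff-+ₚ (scale a p) (scale a r) i ⟨
  coeff (scale a p +ₚ scale a r) i         ∎
  where open ≡-Reasoning

scale-negₚ : ∀ a p → scale a (negₚ p) ≋ negₚ (scale a p)
scale-negₚ a p = scale-lift a λ i → begin
  a *ℚ coeff (negₚ p) i  ≡⟨ cong (a *ℚ_) (coeff-negₚ p i) ⟩
  a *ℚ - coeff p i       ≡⟨ -‿distribʳ-* a (coeff p i) ⟨
  - (a *ℚ coeff p i)     ≡⟨ cong -_ (coeff-scale a p i) ⟨
  - coeff (scale a p) i  ≡⟨ coeff-negₚ (scale a p) i ⟨
  coeff (negₚ (scale a p)) i ∎
  where open ≡-Reasoning

scale-shift : ∀ a b p → scale a (shift b p) ≋ shift b (scale a p)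
scale-shift a zero    p = ≋-refl
scale-shift a (suc b) p = mk≋ λ
  { zero    → ℚ.*-zeroʳ a
  ; (suc i) → coeff-≡ (scale-shift a b p) i }

*ₚ-zeroʳ : ∀ p → p *ₚ [] ≋ []
*ₚ-zeroʳ []      = ≋-refl
*ₚ-zeroʳ (a ∷ p) = ≋-trans (∷-cong (*ₚ-zeroʳ p)) (shift-[] 1)

*ₚ-identityʳ : ∀ p → p *ₚ (1ℚ ∷ []) ≋ p
*ₚ-identityʳ []      = ≋-refl
*ₚ-identityʳ (a ∷ p) = mk≋ λ
  { zero    → trans (ℚ.+-identityʳ (a *ℚ 1ℚ)) (ℚ.*-identityʳ a)
  ; (suc i) → coeff-≡ (*ₚ-identityʳ p) i }

*ₚ-distribˡ-+ₚ : ∀ p r s → p *ₚ (r +ₚ s) ≋ p *ₚ r +ₚ p *ₚ s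
*ₚ-distribˡ-+ₚ []      r s = ≋-refl
*ₚ-distribˡ-+ₚ (a ∷ p) r s = begin
  scale a (r +ₚ s) +ₚ shift 1 (p *ₚ (r +ₚ s))
    ≈⟨ +ₚ-cong (scale-+ₚ a r s) (shift-cong 1 (*ₚ-distribˡ-+ₚ p r s)) ⟩
  (scale a r +ₚ scale a s) +ₚ shift 1 (p *ₚ r +ₚ p *ₚ s)
    ≈⟨ +ₚ-congˡ (shift-+ₚ 1 (p *ₚ r) (p *ₚ s)) ⟩
  (scale a r +ₚ scale a s) +ₚ (shift 1 (p *ₚ r) +ₚ shift 1 (p *ₚ s))
    ≈⟨ +ₚ-interchange (scale a r) (scale a s) _ _ ⟩
  (a ∷ p) *ₚ r +ₚ (a ∷ p) *ₚ s
    ∎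
  where open ≋-Reasoning

*ₚ-negₚʳ : ∀ p r → p *ₚ negₚ r ≋ negₚ (p *ₚ r)
*ₚ-negₚʳ []      r = ≋-refl
*ₚ-negₚʳ (a ∷ p) r = begin
  scale a (negₚ r) +ₚ shift 1 (p *ₚ negₚ r)
    ≈⟨ +ₚ-cong (scale-negₚ a r) (shift-cong 1 (*ₚ-negₚʳ p r)) ⟩
  negₚ (scale a r) +ₚ negₚ (shift 1 (p *ₚ r))
    ≈⟨ negₚ-+ₚ (scale a r) (shift 1 (p *ₚ r)) ⟨
  negₚ ((a ∷ p) *ₚ r)
    ∎
  where open ≋-Reasoning

*ₚ-shiftʳ : ∀ p b r → p *ₚ shift b r ≋ shift b (p *ₚ r)
*ₚ-shiftʳ []      b r = ≋-sym (shift-[] b)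
*ₚ-shiftʳ (a ∷ p) b r = begin
  scale a (shift b r) +ₚ shift 1 (p *ₚ shift b r)
    ≈⟨ +ₚ-cong (scale-shift a b r) (shift-cong 1 (*ₚ-shiftʳ p b r)) ⟩
  shift b (scale a r) +ₚ shift 1 (shift b (p *ₚ r))
    ≡⟨ cong (shift b (scale a r) +ₚ_) (shift-comm 1 b (p *ₚ r)) ⟩
  shift b (scale a r) +ₚ shift b (shift 1 (p *ₚ r))
    ≈⟨ shift-+ₚ b (scale a r) (shift 1 (p *ₚ r)) ⟨
  shift b ((a ∷ p) *ₚ r)
    ∎
  where open ≋-Reasoning

*ₚ-monomialʳ : ∀ p b → p *ₚ monomial b ≋ shift b p
*ₚ-monomialʳ p b = ≋-trans (*ₚ-shiftʳ p b (1ℚ ∷ [])) (shift-cong b (*ₚ-identityʳ p))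

qint-+ : ∀ x y → qint (x + y) ≋ qint x +ₚ shift x (qint y)
qint-+ zero    y = ≋-refl
qint-+ (suc x) y = mk≋ λ
  { zero    → sym (ℚ.+-identityʳ 1ℚ)
  ; (suc i) → coeff-≡ (qint-+ x y) i }

geometric : ℕ → ℕ → Poly → Poly
geometric D zero    p = []
geometric D (suc u) p = p +ₚ shift D (geometric D u p)

geometric-cong : ∀ D u {p r} → p ≋ r → geometric D u p ≋ geometric D u r
geometric-cong D zero    e = ≋-refl
geometric-cong D (suc u) e = +ₚ-cong e (shift-cong D (geometric-cong D u e))

geometric-[] : ∀ D u → geometric D u [] ≋ []
geometric-[] D zero    = ≋-refl
geometric-[] D (suc u) = ≋-trans (shift-cong D (geometric-[] D u)) (shift-[] D)

geometric-+ₚ : ∀ D u p r → geometric D u (p +ₚ r) ≋ geometric D u p +ₚ geometric D u r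
geometric-+ₚ D zero    p r = ≋-refl
geometric-+ₚ D (suc u) p r = begin
  (p +ₚ r) +ₚ shift D (geometric D u (p +ₚ r))
    ≈⟨ +ₚ-congˡ (shift-cong D (geometric-+ₚ D u p r)) ⟩
  (p +ₚ r) +ₚ shift D (geometric D u p +ₚ geometric D u r)
    ≈⟨ +ₚ-congˡ (shift-+ₚ D _ _) ⟩
  (p +ₚ r) +ₚ (shift D (geometric D u p) +ₚ shift D (geometric D u r))
    ≈⟨ +ₚ-interchange p r _ _ ⟩
  geometric D (suc u) p +ₚ geometric D (suc u) r
    ∎
  where open ≋-Reasoning

geometric-shift : ∀ D u a p → geometric D u (shift a p) ≋ shift a (geometric D u p)
geometric-shift D zero    a p = ≋-sym (shift-[] a)
geometric-shift D (suc u) a p = begin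
  shift a p +ₚ shift D (geometric D u (shift a p))
    ≈⟨ +ₚ-congˡ (shift-cong D (geometric-shift D u a p)) ⟩
  shift a p +ₚ shift D (shift a (geometric D u p))
    ≡⟨ cong (shift a p +ₚ_) (shift-comm D a _) ⟩
  shift a p +ₚ shift a (shift D (geometric D u p))
    ≈⟨ shift-+ₚ a p _ ⟨
  shift a (geometric D (suc u) p)
    ∎
  where open ≋-Reasoning

*ₚ-geometricʳ : ∀ p D u r → p *ₚ geometric D u r ≋ geometric D u (p *ₚ r)
*ₚ-geometricʳ p D zero    r = *ₚ-zeroʳ p
*ₚ-geometricʳ p D (suc u) r = begin
  p *ₚ (r +ₚ shift D (geometric D u r))
    ≈⟨ *ₚ-distribˡ-+ₚ p r _ ⟩
  p *ₚ r +ₚ p *ₚ shift D (geometric D u r)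
    ≈⟨ +ₚ-congˡ (*ₚ-shiftʳ p D _) ⟩
  p *ₚ r +ₚ shift D (p *ₚ geometric D u r)
    ≈⟨ +ₚ-congˡ (shift-cong D (*ₚ-geometricʳ p D u r)) ⟩
  geometric D (suc u) (p *ₚ r)
    ∎
  where open ≋-Reasoning

geometric-qint : ∀ D u → geometric D u (qint D) ≋ qint (u * D)
geometric-qint D zero    = ≋-refl
geometric-qint D (suc u) =
  ≋-trans (+ₚ-congˡ (shift-cong D (geometric-qint D u))) (≋-sym (qint-+ D (u * D)))

module _ {A : Set} where

  sumₚ : (A → Poly) → List A → Poly
  sumₚ f = foldr (λ x acc → f x +ₚ acc) []

  sumₚ-cong : ∀ {f g} L → (∀ {x} → x ∈ L → f x ≋ g x) → sumₚ f L ≋ sumₚ g L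
  sumₚ-cong []      e = ≋-refl
  sumₚ-cong (x ∷ L) e = +ₚ-cong (e (here refl)) (sumₚ-cong L (e ∘ there))

  sumₚ-+ₚ : ∀ f g L → sumₚ (λ x → f x +ₚ g x) L ≋ sumₚ f L +ₚ sumₚ g L
  sumₚ-+ₚ f g []      = ≋-refl
  sumₚ-+ₚ f g (x ∷ L) =
    ≋-trans (+ₚ-congˡ (sumₚ-+ₚ f g L)) (+ₚ-interchange (f x) (g x) (sumₚ f L) (sumₚ g L))

  sumₚ-geometric : ∀ D u f L → sumₚ (λ x → geometric D u (f x)) L ≋ geometric D u (sumₚ f L)
  sumₚ-geometric D u f []      = ≋-sym (geometric-[] D u)
  sumₚ-geometric D u f (x ∷ L) =
    ≋-trans (+ₚ-congˡ (sumₚ-geometric D u f L)) (≋-sym (geometric-+ₚ D u (f x) (sumₚ f L)))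

  *ₚ-sumₚ : ∀ p f L → p *ₚ sumₚ f L ≋ sumₚ (λ x → p *ₚ f x) L
  *ₚ-sumₚ p f []      = *ₚ-zeroʳ p
  *ₚ-sumₚ p f (x ∷ L) =
    ≋-trans (*ₚ-distribˡ-+ₚ p (f x) (sumₚ f L)) (+ₚ-congˡ (*ₚ-sumₚ p f L))

  sumₚ-↭ : ∀ f {L L′} → L ↭ L′ → sumₚ f L ≋ sumₚ f L′
  sumₚ-↭ f ↭.refl         = ≋-refl
  sumₚ-↭ f (↭.prep x p)   = +ₚ-congˡ (sumₚ-↭ f p)
  sumₚ-↭ f (↭.swap {xs} {ys} x y p) = begin
    f x +ₚ (f y +ₚ sumₚ f xs)  ≈⟨ +ₚ-assoc (f x) (f y) _ ⟨
    (f x +ₚ f y) +ₚ sumₚ f xs  ≈⟨ +ₚ-cong (+ₚ-comm (f x) (f y)) (sumₚ-↭ f p) ⟩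
    (f y +ₚ f x) +ₚ sumₚ f ys  ≈⟨ +ₚ-assoc (f y) (f x) _ ⟩
    f y +ₚ (f x +ₚ sumₚ f ys)  ∎
    where open ≋-Reasoning
  sumₚ-↭ f (↭.trans p q)  = ≋-trans (sumₚ-↭ f p) (sumₚ-↭ f q)

  sumₚ-map : ∀ f (φ : A → A) L → sumₚ f (map φ L) ≡ sumₚ (f ∘ φ) L
  sumₚ-map f φ []      = refl
  sumₚ-map f φ (x ∷ L) = cong (f (φ x) +ₚ_) (sumₚ-map f φ L)

module _ {A : Set} (_≟_ : DecidableEquality A) {L : List A} (L! : Unique L) (φ : A → A)
         (φ-∈ : ∀ {x} → x ∈ L → φ x ∈ L) (φ-involutive : ∀ {x} → x ∈ L → φ (φ x) ≡ x) where

  open DecMembership _≟_ using (_∈?_)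

  -- φ extended by the identity off L, an involution of all of A and hence injective.
  φ̂ : A → A
  φ̂ x with x ∈? L
  ... | yes _ = φ x
  ... | no  _ = x

  φ̂-∈ : ∀ {x} → x ∈ L → φ̂ x ≡ φ x
  φ̂-∈ {x} x∈L with x ∈? L
  ... | yes _   = refl
  ... | no  x∉L = contradiction x∈L x∉L

  φ̂-involutive : ∀ x → φ̂ (φ̂ x) ≡ x
  φ̂-involutive x with x ∈? L
  ... | yes x∈L = trans (φ̂-∈ (φ-∈ x∈L)) (φ-involutive x∈L)
  ... | no  x∉L with x ∈? L
  ...   | yes x∈L = contradiction x∈L x∉L
  ...   | no  _   = refl

  φ̂-injective : ∀ {x y} → φ̂ x ≡ φ̂ y → x ≡ y
  φ̂-injective {x} {y} e = trans (sym (φ̂-involutive x)) (trans (cong φ̂ e) (φ̂-involutive y))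

  map-φ̂≡map-φ : ∀ {M} → (∀ {x} → x ∈ M → x ∈ L) → map φ̂ M ≡ map φ M
  map-φ̂≡map-φ {[]}    M⊆L = refl
  map-φ̂≡map-φ {x ∷ M} M⊆L = cong₂ _∷_ (φ̂-∈ (M⊆L (here refl))) (map-φ̂≡map-φ (M⊆L ∘ there))

  map-φ̂-↭ : map φ̂ L ↭ L
  map-φ̂-↭ = ∼bag⇒↭ (unique∧set⇒bag (Unique.map⁺ φ̂-injective L!) L! (mk⇔ to from))
    where
    to : ∀ {x} → x ∈ map φ̂ L → x ∈ L
    to x∈φ̂L with ∈-map⁻ φ̂ x∈φ̂L
    ... | y , y∈L , refl = subst (_∈ L) (sym (φ̂-∈ y∈L)) (φ-∈ y∈L)
    from : ∀ {x} → x ∈ L → x ∈ map φ̂ L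
    from {x} x∈L = subst (_∈ map φ̂ L) (φ̂-involutive x)
      (∈-map⁺ φ̂ (subst (_∈ L) (sym (φ̂-∈ x∈L)) (φ-∈ x∈L)))

  sumₚ-∘-involution : ∀ f → sumₚ (f ∘ φ) L ≋ sumₚ f L
  sumₚ-∘-involution f = ≋-trans (≋-reflexive (sym (sumₚ-map f φ L)))
    (≋-trans (≋-reflexive (cong (sumₚ f) (sym (map-φ̂≡map-φ (λ x∈L → x∈L))))) (sumₚ-↭ f map-φ̂-↭))

-- Divisibility by a polynomial

infix 4 _∣ₚ_
record _∣ₚ_ (d p : Poly) : Set where
  constructor divides
  field
    quotient : Poly
    equality : d *ₚ quotient ≋ p

∣ₚ-resp-≋ : ∀ {d p r} → p ≋ r → d ∣ₚ p → d ∣ₚ r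
∣ₚ-resp-≋ e (divides w dw≋p) = divides w (≋-trans dw≋p e)

∣ₚ-+ₚ : ∀ {d p r} → d ∣ₚ p → d ∣ₚ r → d ∣ₚ p +ₚ r
∣ₚ-+ₚ {d} (divides v dv≋p) (divides w dw≋r) =
  divides (v +ₚ w) (≋-trans (*ₚ-distribˡ-+ₚ d v w) (+ₚ-cong dv≋p dw≋r))

∣ₚ-shift : ∀ {d p} a → d ∣ₚ p → d ∣ₚ shift a p
∣ₚ-shift {d} a (divides w dw≋p) =
  divides (shift a w) (≋-trans (*ₚ-shiftʳ d a w) (shift-cong a dw≋p))

∣ₚ-geometric : ∀ {d p} D u → d ∣ₚ p → d ∣ₚ geometric D u p
∣ₚ-geometric {d} D u (divides w dw≋p) =
  divides (geometric D u w) (≋-trans (*ₚ-geometricʳ d D u w) (geometric-cong D u dw≋p))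

∣ₚ-sumₚ : ∀ {A : Set} {d} (f : A → Poly) L → (∀ {x} → x ∈ L → d ∣ₚ f x) → d ∣ₚ sumₚ f L
∣ₚ-sumₚ {d = d} f []      h = divides [] (*ₚ-zeroʳ d)
∣ₚ-sumₚ         f (x ∷ L) h = ∣ₚ-+ₚ (h (here refl)) (∣ₚ-sumₚ f L (h ∘ there))

∣ₚ-+ₚ-cancelʳ : ∀ {d p r} → d ∣ₚ p +ₚ r → d ∣ₚ r → d ∣ₚ p
∣ₚ-+ₚ-cancelʳ {d} {p} {r} (divides v dv≋p+r) (divides w dw≋r) = divides (v +ₚ negₚ w) (begin
  d *ₚ (v +ₚ negₚ w)           ≈⟨ *ₚ-distribˡ-+ₚ d v (negₚ w) ⟩
  d *ₚ v +ₚ d *ₚ negₚ w        ≈⟨ +ₚ-cong dv≋p+r (≋-trans (*ₚ-negₚʳ d w) (negₚ-cong dw≋r)) ⟩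
  (p +ₚ r) +ₚ negₚ r           ≈⟨ +ₚ-assoc p r (negₚ r) ⟩
  p +ₚ (r +ₚ negₚ r)           ≈⟨ +ₚ-congˡ (+ₚ-inverseʳ r) ⟩
  p +ₚ []                      ≈⟨ +ₚ-identityʳ p ⟩
  p                            ∎)
  where open ≋-Reasoning

qint-∣ₚ-qint-* : ∀ c N → qint N ∣ₚ qint (c * N)
qint-∣ₚ-qint-* c N = ∣ₚ-resp-≋ (geometric-qint N c)
  (∣ₚ-geometric N c (divides (1ℚ ∷ []) (*ₚ-identityʳ (qint N))))

-- Divisibility of the tableau sums by [N]_q

module _ {A : Set} (L : List A) (a b c : A → ℕ) (N D : ℕ)
         (a+cN≡b+D : ∀ {x} → x ∈ L → a x + c x * N ≡ b x + D)
         (a↭b : ∀ (h : ℕ → Poly) → sumₚ (λ x → h (b x)) L ≋ sumₚ (λ x → h (a x)) L) where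

  -- [b]+q^b[D] = [b+D] = [a+cN] = [a]+q^a[cN]; summed over L the [a] and [b] cancel.
  qint-∣ₚ-sumₚ-shift-qint : qint N ∣ₚ sumₚ (λ x → shift (a x) (qint D)) L
  qint-∣ₚ-sumₚ-shift-qint = ∣ₚ-resp-≋ (≋-sym shifted-qint-D≋)
    (∣ₚ-sumₚ _ L λ {x} _ → ∣ₚ-shift (a x) (qint-∣ₚ-qint-* (c x) N))
    where
    open ≋-Reasoning
    pointwise : ∀ {x} → x ∈ L →
      qint (b x) +ₚ shift (b x) (qint D) ≋ qint (a x) +ₚ shift (a x) (qint (c x * N))
    pointwise {x} x∈L = begin
      qint (b x) +ₚ shift (b x) (qint D) ≈⟨ qint-+ (b x) D ⟨
      qint (b x + D)                     ≡⟨ cong qint (a+cN≡b+D x∈L) ⟨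
      qint (a x + c x * N)               ≈⟨ qint-+ (a x) (c x * N) ⟩
      qint (a x) +ₚ shift (a x) (qint (c x * N)) ∎
    shifted-qint-D≋ :
      sumₚ (λ x → shift (a x) (qint D)) L ≋ sumₚ (λ x → shift (a x) (qint (c x * N))) L
    shifted-qint-D≋ = +ₚ-cancelˡ (sumₚ (λ x → qint (a x)) L) (begin
      sumₚ (λ x → qint (a x)) L +ₚ sumₚ (λ x → shift (a x) (qint D)) L
        ≈⟨ +ₚ-cong (a↭b qint) (a↭b (λ e → shift e (qint D))) ⟨
      sumₚ (λ x → qint (b x)) L +ₚ sumₚ (λ x → shift (b x) (qint D)) L
        ≈⟨ sumₚ-+ₚ _ _ L ⟨
      sumₚ (λ x → qint (b x) +ₚ shift (b x) (qint D)) L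
        ≈⟨ sumₚ-cong L pointwise ⟩
      sumₚ (λ x → qint (a x) +ₚ shift (a x) (qint (c x * N))) L
        ≈⟨ sumₚ-+ₚ _ _ L ⟩
      sumₚ (λ x → qint (a x)) L +ₚ sumₚ (λ x → shift (a x) (qint (c x * N))) L ∎)

-- Multiplying by 1 + q^D + ⋯ + q^((u-1)D) turns [D] into [uD] = [k] + q^k [tN].
qint-∣ₚ-qint-*-sumₚ-monomial : ∀ {A : Set} (L : List A) (a : A → ℕ) (N D k u t : ℕ) →
  u * D ≡ k + t * N →
  qint N ∣ₚ sumₚ (λ x → shift (a x) (qint D)) L →
  qint N ∣ₚ qint k *ₚ sumₚ (λ x → monomial (a x)) L
qint-∣ₚ-qint-*-sumₚ-monomial L a N D k u t uD≡k+tN N∣Σ =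
  ∣ₚ-resp-≋ (≋-sym k*Σ≋) (∣ₚ-+ₚ-cancelʳ (∣ₚ-resp-≋ geometric-Σ≋ (∣ₚ-geometric D u N∣Σ))
    (∣ₚ-sumₚ _ L λ {x} _ → ∣ₚ-shift (a x) (∣ₚ-shift k (qint-∣ₚ-qint-* t N))))
  where
  open ≋-Reasoning
  pointwise : ∀ e →
    geometric D u (shift e (qint D)) ≋ shift e (qint k) +ₚ shift e (shift k (qint (t * N)))
  pointwise e = begin
    geometric D u (shift e (qint D))  ≈⟨ geometric-shift D u e (qint D) ⟩
    shift e (geometric D u (qint D))  ≈⟨ shift-cong e (geometric-qint D u) ⟩
    shift e (qint (u * D))            ≡⟨ cong (shift e ∘ qint) uD≡k+tN ⟩
    shift e (qint (k + t * N))        ≈⟨ shift-cong e (qint-+ k (t * N)) ⟩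
    shift e (qint k +ₚ shift k (qint (t * N))) ≈⟨ shift-+ₚ e _ _ ⟩
    shift e (qint k) +ₚ shift e (shift k (qint (t * N))) ∎
  geometric-Σ≋ : geometric D u (sumₚ (λ x → shift (a x) (qint D)) L) ≋
    sumₚ (λ x → shift (a x) (qint k)) L +ₚ sumₚ (λ x → shift (a x) (shift k (qint (t * N)))) L
  geometric-Σ≋ = ≋-trans (≋-sym (sumₚ-geometric D u _ L))
    (≋-trans (sumₚ-cong L (λ {x} _ → pointwise (a x))) (sumₚ-+ₚ _ _ L))
  k*Σ≋ : qint k *ₚ sumₚ (λ x → monomial (a x)) L ≋ sumₚ (λ x → shift (a x) (qint k)) L
  k*Σ≋ = ≋-trans (*ₚ-sumₚ (qint k) _ L) (sumₚ-cong L (λ {x} _ → *ₚ-monomialʳ (qint k) (a x)))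

-- Weakly increasing rows through their counting functions

count< : List ℕ → ℕ → ℕ
count< []      v = 0
count< (a ∷ r) v with a <? v
... | yes _ = suc (count< r v)
... | no  _ = count< r v

count<-∷-< : ∀ {a v} r → a < v → count< (a ∷ r) v ≡ suc (count< r v)
count<-∷-< {a} {v} r a<v with a <? v
... | yes _   = refl
... | no  a≮v = contradiction a<v a≮v

count<-∷-≥ : ∀ {a v} r → v ≤ a → count< (a ∷ r) v ≡ count< r v
count<-∷-≥ {a} {v} r v≤a with a <? v
... | yes a<v = contradiction a<v (≤⇒≯ v≤a)
... | no  _   = refl

count<-∷-≤ : ∀ a r v → count< (a ∷ r) v ≤ suc (count< r v)
count<-∷-≤ a r v with a <? v
... | yes _ = ≤-refl
... | no  _ = n≤1+n _

count<-none : ∀ {v} r → All (v ≤_) r → count< r v ≡ 0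
count<-none []      []           = refl
count<-none (a ∷ r) (v≤a ∷ v≤r) = trans (count<-∷-≥ r v≤a) (count<-none r v≤r)

count<-zero : ∀ r → count< r 0 ≡ 0
count<-zero r = count<-none r (All.universal (λ _ → z≤n) r)

count<-mono : ∀ r {v w} → v ≤ w → count< r v ≤ count< r w
count<-mono []      v≤w = z≤n
count<-mono (a ∷ r) {v} {w} v≤w with a <? v | a <? w
... | yes _   | yes _   = s≤s (count<-mono r v≤w)
... | yes a<v | no  a≮w = contradiction (<-≤-trans a<v v≤w) a≮w
... | no  _   | yes _   = m≤n⇒m≤1+n (count<-mono r v≤w)
... | no  _   | no  _   = count<-mono r v≤w

count<-++ : ∀ xs ys v → count< (xs ++ ys) v ≡ count< xs v + count< ys v
count<-++ []       ys v = refl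
count<-++ (a ∷ xs) ys v with a <? v
... | yes _ = cong suc (count<-++ xs ys v)
... | no  _ = count<-++ xs ys v

count<-replicate-< : ∀ c {e v} → e < v → count< (replicate c e) v ≡ c
count<-replicate-< zero    e<v = refl
count<-replicate-< (suc c) e<v =
  trans (count<-∷-< (replicate c _) e<v) (cong suc (count<-replicate-< c e<v))

count<-replicate-≥ : ∀ c {e v} → v ≤ e → count< (replicate c e) v ≡ 0
count<-replicate-≥ c v≤e = count<-none (replicate c _) (replicate⁺ c v≤e)

count<-filter<-≥ : ∀ {i w} r → i ≤ w → count< (filter (_<? i) r) w ≡ count< r i
count<-filter<-≥ []      i≤w = refl
count<-filter<-≥ {i} {w} (a ∷ r) i≤w with a <? i
... | yes a<i = begin
  count< (filter (_<? i) (a ∷ r)) w  ≡⟨ cong (λ z → count< z w) (filter-accept (_<? i) a<i) ⟩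
  count< (a ∷ filter (_<? i) r) w    ≡⟨ count<-∷-< (filter (_<? i) r) (<-≤-trans a<i i≤w) ⟩
  suc (count< (filter (_<? i) r) w)  ≡⟨ cong suc (count<-filter<-≥ r i≤w) ⟩
  suc (count< r i)                   ∎
  where open ≡-Reasoning
... | no  a≮i = trans (cong (λ z → count< z w) (filter-reject (_<? i) a≮i)) (count<-filter<-≥ r i≤w)

count<-filter<-≤ : ∀ {i w} r → w ≤ i → count< (filter (_<? i) r) w ≡ count< r w
count<-filter<-≤ []      w≤i = refl
count<-filter<-≤ {i} {w} (a ∷ r) w≤i with a <? w
... | yes a<w = begin
  count< (filter (_<? i) (a ∷ r)) w  ≡⟨ cong (λ z → count< z w) (filter-accept (_<? i) (<-≤-trans a<w w≤i)) ⟩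
  count< (a ∷ filter (_<? i) r) w    ≡⟨ count<-∷-< (filter (_<? i) r) a<w ⟩
  suc (count< (filter (_<? i) r) w)  ≡⟨ cong suc (count<-filter<-≤ r w≤i) ⟩
  suc (count< r w)                   ∎
  where open ≡-Reasoning
... | no  a≮w with a <? i
...   | yes a<i = trans (cong (λ z → count< z w) (filter-accept (_<? i) a<i))
                    (trans (count<-∷-≥ (filter (_<? i) r) (≮⇒≥ a≮w)) (count<-filter<-≤ r w≤i))
...   | no  a≮i = trans (cong (λ z → count< z w) (filter-reject (_<? i) a≮i)) (count<-filter<-≤ r w≤i)

count<-filter≥-≤ : ∀ {i w} r → w ≤ i → count< (filter (i ≤?_) r) w ≡ 0
count<-filter≥-≤ {i} r w≤i = count<-none (filter (i ≤?_) r) (All.map (≤-trans w≤i) (all-filter (i ≤?_) r))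

data IncRow (lo N : ℕ) : List ℕ → Set where
  inc[] : IncRow lo N []
  inc∷  : ∀ {x r} → lo ≤ x → x < N → IncRow x N r → IncRow lo N (x ∷ r)

IncRow-weaken : ∀ {lo lo′ N r} → lo′ ≤ lo → IncRow lo N r → IncRow lo′ N r
IncRow-weaken lo′≤lo inc[]              = inc[]
IncRow-weaken lo′≤lo (inc∷ lo≤x x<N r) = inc∷ (≤-trans lo′≤lo lo≤x) x<N r

IncRow⇒All≥ : ∀ {lo N r} → IncRow lo N r → All (lo ≤_) r
IncRow⇒All≥ inc[]              = []
IncRow⇒All≥ (inc∷ lo≤x x<N r) = lo≤x ∷ All.map (≤-trans lo≤x) (IncRow⇒All≥ r)

IncRow-raise : ∀ {lo m N r} → All (m ≤_) r → IncRow lo N r → IncRow m N r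
IncRow-raise []           inc[]          = inc[]
IncRow-raise (m≤x ∷ _)   (inc∷ _ x<N r) = inc∷ m≤x x<N r

IncRow-++ : ∀ {lo m N xs ys} → IncRow lo N xs → All (_≤ m) xs → lo ≤ m → IncRow m N ys → IncRow lo N (xs ++ ys)
IncRow-++ inc[]              []           lo≤m ys = IncRow-weaken lo≤m ys
IncRow-++ (inc∷ lo≤x x<N xs) (x≤m ∷ xs≤m) _    ys = inc∷ lo≤x x<N (IncRow-++ xs xs≤m x≤m ys)

IncRow-filter : ∀ {lo N r} {P : ℕ → Set} (P? : ∀ x → Dec (P x)) →
  IncRow lo N r → IncRow lo N (filter P? r)
IncRow-filter P? inc[] = inc[]
IncRow-filter P? (inc∷ {x} lo≤x x<N r) with P? x
... | yes _ = inc∷ lo≤x x<N (IncRow-filter P? r)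
... | no  _ = IncRow-weaken lo≤x (IncRow-filter P? r)

IncRow-replicate : ∀ {lo N e} c → lo ≤ e → e < N → IncRow lo N (replicate c e)
IncRow-replicate zero    lo≤e e<N = inc[]
IncRow-replicate (suc c) lo≤e e<N = inc∷ lo≤e e<N (IncRow-replicate c ≤-refl e<N)

count<-length : ∀ {lo N} r → IncRow lo N r → count< r N ≡ length r
count<-length []      inc[]            = refl
count<-length (a ∷ r) (inc∷ _ a<N r′) = trans (count<-∷-< r a<N) (cong suc (count<-length r r′))

filter<-none : ∀ {v} xs → All (v ≤_) xs → filter (_<? v) xs ≡ []
filter<-none {v} xs v≤xs = filter-none (_<? v) (All.map ≤⇒≯ v≤xs)

filter≥-none : ∀ {v} xs → All (_< v) xs → filter (v ≤?_) xs ≡ []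
filter≥-none {v} xs xs<v = filter-none (v ≤?_) (All.map <⇒≱ xs<v)

refill : ℕ → List ℕ → ℕ → ℕ → List ℕ
refill i r α β = filter (_<? i) r ++ (replicate α i ++ (replicate β (suc i) ++ filter (suc (suc i) ≤?_) r))

filter<-refill : ∀ i r α β → filter (_<? i) (refill i r α β) ≡ filter (_<? i) r
filter<-refill i r α β = begin
  filter (_<? i) (refill i r α β)
    ≡⟨ filter-++ (_<? i) (filter (_<? i) r) _ ⟩
  filter (_<? i) (filter (_<? i) r) ++ filter (_<? i) (replicate α i ++ (replicate β (suc i) ++ high))
    ≡⟨ cong₂ _++_ (filter-idem (_<? i) r) middle-and-high ⟩
  filter (_<? i) r ++ []
    ≡⟨ ++-identityʳ _ ⟩
  filter (_<? i) r
    ∎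
  where
  open ≡-Reasoning
  high = filter (suc (suc i) ≤?_) r
  middle-and-high : filter (_<? i) (replicate α i ++ (replicate β (suc i) ++ high)) ≡ []
  middle-and-high = filter<-none (replicate α i ++ (replicate β (suc i) ++ high))
    (++⁺ (replicate⁺ α ≤-refl) (++⁺ (replicate⁺ β (n≤1+n i))
      (All.map (≤-trans (m≤n+m i 2)) (all-filter (suc (suc i) ≤?_) r))))

filter≥-refill : ∀ i r α β → filter (suc (suc i) ≤?_) (refill i r α β) ≡ filter (suc (suc i) ≤?_) r
filter≥-refill i r α β = begin
  filter (2+i ≤?_) (filter (_<? i) r ++ (replicate α i ++ (replicate β (suc i) ++ high)))
    ≡⟨ filter-++ (2+i ≤?_) (filter (_<? i) r) _ ⟩
  filter (2+i ≤?_) (filter (_<? i) r) ++ filter (2+i ≤?_) (replicate α i ++ (replicate β (suc i) ++ high))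
    ≡⟨ cong₂ _++_ low (filter-++ (2+i ≤?_) (replicate α i) _) ⟩
  filter (2+i ≤?_) (replicate α i) ++ filter (2+i ≤?_) (replicate β (suc i) ++ high)
    ≡⟨ cong₂ _++_ (filter≥-none (replicate α i) (replicate⁺ α (m<n+m i z<s)))
                  (filter-++ (2+i ≤?_) (replicate β (suc i)) high) ⟩
  filter (2+i ≤?_) (replicate β (suc i)) ++ filter (2+i ≤?_) high
    ≡⟨ cong₂ _++_ (filter≥-none (replicate β (suc i)) (replicate⁺ β ≤-refl)) (filter-idem (2+i ≤?_) r) ⟩
  filter (2+i ≤?_) r
    ∎
  where
  open ≡-Reasoning
  2+i = suc (suc i)
  high = filter (2+i ≤?_) r
  low : filter (2+i ≤?_) (filter (_<? i) r) ≡ []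
  low = filter≥-none (filter (_<? i) r) (All.map (λ x<i → <-trans x<i (m<n+m i z<s)) (all-filter (_<? i) r))

refill-refill : ∀ i r α β α′ β′ → refill i (refill i r α β) α′ β′ ≡ refill i r α′ β′
refill-refill i r α β α′ β′ = cong₂ (λ low high → low ++ (replicate α′ i ++ (replicate β′ (suc i) ++ high)))
  (filter<-refill i r α β) (filter≥-refill i r α β)

count<-refill : ∀ i r α β w → count< (refill i r α β) w ≡
  count< (filter (_<? i) r) w + (count< (replicate α i) w +
    (count< (replicate β (suc i)) w + count< (filter (suc (suc i) ≤?_) r) w))
count<-refill i r α β w = trans (count<-++ (filter (_<? i) r) _ w)
  (cong (count< (filter (_<? i) r) w +_) (trans (count<-++ (replicate α i) _ w)
    (cong (count< (replicate α i) w +_) (count<-++ (replicate β (suc i)) _ w))))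

count<-refill-≤ : ∀ i r α β w → w ≤ i → count< (refill i r α β) w ≡ count< r w
count<-refill-≤ i r α β w w≤i
  rewrite count<-refill i r α β w | count<-filter<-≤ r w≤i
        | count<-replicate-≥ α w≤i | count<-replicate-≥ β (m≤n⇒m≤1+n w≤i)
        | count<-filter≥-≤ r (m≤n⇒m≤1+n (m≤n⇒m≤1+n w≤i)) = +-identityʳ (count< r w)

count<-refill-suc : ∀ i r α β → count< (refill i r α β) (suc i) ≡ count< r i + α
count<-refill-suc i r α β
  rewrite count<-refill i r α β (suc i) | count<-filter<-≥ {i} {suc i} r (n≤1+n i)
        | count<-replicate-< α {i} {suc i} ≤-refl | count<-replicate-≥ β {suc i} {suc i} ≤-refl
        | count<-filter≥-≤ {suc (suc i)} {suc i} r (n≤1+n (suc i)) = cong (count< r i +_) (+-identityʳ α)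

IncRow-refill : ∀ i {N} r α β → IncRow 0 N r → suc i < N → IncRow 0 N (refill i r α β)
IncRow-refill i r α β r↑ 1+i<N =
  IncRow-++ (IncRow-filter (_<? i) r↑) (All.map <⇒≤ (all-filter (_<? i) r)) z≤n
    (IncRow-++ (IncRow-replicate α ≤-refl (<-trans (n<1+n i) 1+i<N)) (replicate⁺ α ≤-refl) ≤-refl
      (IncRow-weaken (n≤1+n i) (IncRow-++ (IncRow-replicate β ≤-refl 1+i<N) (replicate⁺ β ≤-refl) ≤-refl
        (IncRow-weaken (n≤1+n (suc i)) (IncRow-raise (all-filter (suc (suc i) ≤?_) r) (IncRow-filter _ r↑))))))

count<-split : ∀ {u v} r → u ≤ v → count< r v ≡ count< r u + count< (filter (u ≤?_) r) v
count<-split []      u≤v = refl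
count<-split {u} {v} (a ∷ r) u≤v with a <? u
... | yes a<u
  rewrite filter-reject (u ≤?_) {xs = r} (<⇒≱ a<u) | count<-∷-< r (<-≤-trans a<u u≤v) =
  cong suc (count<-split r u≤v)
... | no a≮u
  rewrite filter-accept (u ≤?_) {xs = r} (≮⇒≥ a≮u) with a <? v
...   | yes _ = trans (cong suc (count<-split r u≤v)) (sym (+-suc (count< r u) _))
...   | no  _ = count<-split r u≤v

count<-refill-≥ : ∀ i r α β w → suc (suc i) ≤ w → count< r i ≤ count< r (suc (suc i)) →
  α + β ≡ count< r (suc (suc i)) ∸ count< r i → count< (refill i r α β) w ≡ count< r w
count<-refill-≥ i r α β w 2+i≤w c₀≤c₂ α+β≡c₂-c₀ = begin
  count< (refill i r α β) w
    ≡⟨ count<-refill i r α β w ⟩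
  count< (filter (_<? i) r) w + (count< (replicate α i) w + (count< (replicate β (suc i)) w + high))
    ≡⟨ cong₂ (λ x y → x + (y + (count< (replicate β (suc i)) w + high)))
         (count<-filter<-≥ r (≤-trans (m≤n+m i 2) 2+i≤w))
         (count<-replicate-< α (≤-trans (n≤1+n (suc i)) 2+i≤w)) ⟩
  count< r i + (α + (count< (replicate β (suc i)) w + high))
    ≡⟨ cong (λ y → count< r i + (α + (y + high))) (count<-replicate-< β 2+i≤w) ⟩
  count< r i + (α + (β + high))
    ≡⟨ cong (count< r i +_) (sym (+-assoc α β high)) ⟩
  count< r i + ((α + β) + high)
    ≡⟨ cong (λ y → count< r i + (y + high)) α+β≡c₂-c₀ ⟩
  count< r i + ((count< r (suc (suc i)) ∸ count< r i) + high)
    ≡⟨ sym (+-assoc (count< r i) _ high) ⟩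
  (count< r i + (count< r (suc (suc i)) ∸ count< r i)) + high
    ≡⟨ cong (_+ high) (m+[n∸m]≡n c₀≤c₂) ⟩
  count< r (suc (suc i)) + high
    ≡⟨ sym (count<-split r 2+i≤w) ⟩
  count< r w
    ∎
  where
  open ≡-Reasoning
  high = count< (filter (suc (suc i) ≤?_) r) w

count<-suc-head-≢ : ∀ {a b N} r {s} → IncRow b N s → a < b → count< (a ∷ r) (suc a) ≢ count< (b ∷ s) (suc a)
count<-suc-head-≢ {a} {b} r {s} s↑ a<b e = 0≢1+n (begin
  0                          ≡⟨ count<-none (b ∷ s) (a<b ∷ All.map (≤-trans a<b) (IncRow⇒All≥ s↑)) ⟨
  count< (b ∷ s) (suc a)     ≡⟨ e ⟨
  count< (a ∷ r) (suc a)     ≡⟨ count<-∷-< {a} r ≤-refl ⟩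
  suc (count< r (suc a))     ∎)
  where open ≡-Reasoning

count<-injective : ∀ {lo lo′ N N′ r s} → IncRow lo N r → IncRow lo′ N′ s →
  (∀ v → count< r v ≡ count< s v) → r ≡ s
count<-injective inc[] inc[] _ = refl
count<-injective inc[] (inc∷ {b} {s} _ _ _) eq = contradiction (trans (eq (suc b)) (count<-∷-< {b} s ≤-refl)) 0≢1+n
count<-injective (inc∷ {a} {r} _ _ _) inc[] eq = contradiction (trans (sym (eq (suc a))) (count<-∷-< {a} r ≤-refl)) 0≢1+n
count<-injective (inc∷ {a} {r} _ _ r↑) (inc∷ {b} {s} _ _ s↑) eq with <-cmp a b
... | tri< a<b _ _ = contradiction (eq (suc a)) (count<-suc-head-≢ r s↑ a<b)
... | tri> _ _ b<a = contradiction (sym (eq (suc b))) (count<-suc-head-≢ s r↑ b<a)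
... | tri≈ _ refl _ = cong (a ∷_) (count<-injective r↑ s↑ same-tail-counts)
  where
  same-tail-counts : ∀ v → count< r v ≡ count< s v
  same-tail-counts v with a <? v
  ... | yes a<v = suc-injective (trans (sym (count<-∷-< r a<v)) (trans (eq v) (count<-∷-< s a<v)))
  ... | no  a≮v = trans (sym (count<-∷-≥ r (≮⇒≥ a≮v))) (trans (eq v) (count<-∷-≥ s (≮⇒≥ a≮v)))

[n∸m]+[o∸n]≡o∸m : ∀ {m n o} → m ≤ n → n ≤ o → (n ∸ m) + (o ∸ n) ≡ o ∸ m
[n∸m]+[o∸n]≡o∸m {m} {n} {o} m≤n n≤o = +-cancelˡ-≡ m _ _ (begin
  m + ((n ∸ m) + (o ∸ n))  ≡⟨ +-assoc m (n ∸ m) (o ∸ n) ⟨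
  (m + (n ∸ m)) + (o ∸ n)  ≡⟨ cong (_+ (o ∸ n)) (m+[n∸m]≡n m≤n) ⟩
  n + (o ∸ n)              ≡⟨ m+[n∸m]≡n n≤o ⟩
  o                        ≡⟨ m+[n∸m]≡n (≤-trans m≤n n≤o) ⟨
  m + (o ∸ m)              ∎)
  where open ≡-Reasoning

-- the entries i, i+1 of r redistributed so that exactly x entries are ≤ i
rebalance : ℕ → List ℕ → ℕ → List ℕ
rebalance i r x = refill i r (x ∸ count< r i) (count< r (suc (suc i)) ∸ x)

module _ (i : ℕ) (r : List ℕ) {x : ℕ} (c₀≤x : count< r i ≤ x) (x≤c₂ : x ≤ count< r (suc (suc i))) where

  private
    α = x ∸ count< r i
    β = count< r (suc (suc i)) ∸ x

  count<-rebalance-suc : count< (rebalance i r x) (suc i) ≡ x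
  count<-rebalance-suc = trans (count<-refill-suc i r α β) (m+[n∸m]≡n c₀≤x)

  count<-rebalance-≢ : ∀ w → w ≢ suc i → count< (rebalance i r x) w ≡ count< r w
  count<-rebalance-≢ w w≢1+i with w ≤? i
  ... | yes w≤i = count<-refill-≤ i r α β w w≤i
  ... | no  w≰i = count<-refill-≥ i r α β w (≤∧≢⇒< (≰⇒> w≰i) (w≢1+i ∘ sym)) (≤-trans c₀≤x x≤c₂)
                    ([n∸m]+[o∸n]≡o∸m c₀≤x x≤c₂)

  rebalance-rebalance : ∀ y → rebalance i (rebalance i r x) y ≡ rebalance i r y
  rebalance-rebalance y
    rewrite count<-rebalance-≢ i (1+n≢n ∘ sym) | count<-rebalance-≢ (suc (suc i)) 1+n≢n =
    refill-refill i r α β (y ∸ count< r i) (count< r (suc (suc i)) ∸ y)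

IncRow-rebalance : ∀ i {N} r x → IncRow 0 N r → suc i < N → IncRow 0 N (rebalance i r x)
IncRow-rebalance i r x = IncRow-refill i r (x ∸ count< r i) (count< r (suc (suc i)) ∸ x)

rebalance-self : ∀ i {N} r → IncRow 0 N r → suc i < N → rebalance i r (count< r (suc i)) ≡ r
rebalance-self i r r↑ 1+i<N = count<-injective (IncRow-rebalance i r (count< r (suc i)) r↑ 1+i<N) r↑ same-counts
  where
  c₀≤c₁ = count<-mono r (n≤1+n i)
  c₁≤c₂ = count<-mono r (n≤1+n (suc i))
  same-counts : ∀ w → count< (rebalance i r (count< r (suc i))) w ≡ count< r w
  same-counts w with w ≟ suc i
  ... | yes refl = count<-rebalance-suc i r c₀≤c₁ c₁≤c₂
  ... | no  w≢1+i = count<-rebalance-≢ i r c₀≤c₁ c₁≤c₂ w w≢1+i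

-- Semistandard tableaux and Bender–Knuth involutions

Tableau : Set
Tableau = List (List ℕ)

topRow : Tableau → List ℕ
topRow []      = []
topRow (r ∷ _) = r

-- s fits under r with strictly increasing columns (each entry of s exceeds the one above it),
-- expressed through the counting functions.
StrictlyBelow : List ℕ → List ℕ → Set
StrictlyBelow r s = ∀ v → count< s (suc v) ≤ count< r v

data IsSSYT (N : ℕ) : List ℕ → Tableau → Set where
  []   : IsSSYT N [] []
  cons : ∀ {l sh r T} → length r ≡ l → IncRow 0 N r → IsSSYT N sh T → StrictlyBelow r (topRow T) →
         IsSSYT N (l ∷ sh) (r ∷ T)

module Reflection {lo x hi : ℕ} (lo≤x : lo ≤ x) (x≤hi : x ≤ hi) where

  x′ : ℕ
  x′ = (lo + hi) ∸ x

  x′+x≡lo+hi : x′ + x ≡ lo + hi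
  x′+x≡lo+hi = m∸n+n≡m (≤-trans x≤hi (m≤n+m hi lo))

  lo≤x′ : lo ≤ x′
  lo≤x′ = subst (lo ≤_) (sym (+-∸-assoc lo x≤hi)) (m≤m+n lo (hi ∸ x))

  x′≤hi : x′ ≤ hi
  x′≤hi = +-cancelʳ-≤ x x′ hi (subst (_≤ hi + x) (sym x′+x≡lo+hi)
    (subst (lo + hi ≤_) (+-comm x hi) (+-monoˡ-≤ hi lo≤x)))

  reflect-x′ : (lo + hi) ∸ x′ ≡ x
  reflect-x′ = trans (cong (_∸ x′) (sym x′+x≡lo+hi)) (m+n∸m≡n x′ x)

-- For a row r above a row s, with A entries < i in the row above r, the number of entries ≤ i of r
-- may be any value in [lo, hi] = [max(#r<i, #s≤i+1), min(#r≤i+1, A)] without breaking the tableau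
-- conditions; the Bender–Knuth involution BK_i reflects it in that interval.
bkCount : ℕ → ℕ → List ℕ → List ℕ → ℕ
bkCount i A r s = ((count< r i ⊔ count< s (suc (suc i))) + (count< r (suc (suc i)) ⊓ A)) ∸ count< r (suc i)

bkRows : ℕ → ℕ → Tableau → Tableau
bkRows i A []      = []
bkRows i A (r ∷ T) = rebalance i r (bkCount i A r (topRow T)) ∷ bkRows i (count< r i) T

benderKnuth : ℕ → Tableau → Tableau
benderKnuth i []      = []
benderKnuth i (r ∷ T) = bkRows i (count< r (suc (suc i))) (r ∷ T)

module BKRow (i A : ℕ) (r s : List ℕ) (r≻s : StrictlyBelow r s) (c₁≤A : count< r (suc i) ≤ A) where

  lo = count< r i ⊔ count< s (suc (suc i))
  hi = count< r (suc (suc i)) ⊓ A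

  lo≤c₁ : lo ≤ count< r (suc i)
  lo≤c₁ = ⊔-lub (count<-mono r (n≤1+n i)) (r≻s (suc i))

  c₁≤hi : count< r (suc i) ≤ hi
  c₁≤hi = ⊓-glb (count<-mono r (n≤1+n (suc i))) c₁≤A

  open Reflection lo≤c₁ c₁≤hi public

  c₀≤x′ : count< r i ≤ x′
  c₀≤x′ = ≤-trans (m≤m⊔n _ _) lo≤x′

  x′≤c₂ : x′ ≤ count< r (suc (suc i))
  x′≤c₂ = ≤-trans x′≤hi (m⊓n≤m _ _)

  s₂≤x′ : count< s (suc (suc i)) ≤ x′
  s₂≤x′ = ≤-trans (m≤n⊔m _ _) lo≤x′

  x′≤A : x′ ≤ A
  x′≤A = ≤-trans x′≤hi (m⊓n≤n _ _)

  r′ = rebalance i r x′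

  count<-r′-≢ : ∀ w → w ≢ suc i → count< r′ w ≡ count< r w
  count<-r′-≢ = count<-rebalance-≢ i r c₀≤x′ x′≤c₂

  count<-r′-suc : count< r′ (suc i) ≡ x′
  count<-r′-suc = count<-rebalance-suc i r c₀≤x′ x′≤c₂

record BKRowsResult (i N A : ℕ) (sh : List ℕ) (T : Tableau) : Set where
  field
    isSSYT        : IsSSYT N sh (bkRows i A T)
    topRow-≢      : ∀ w → w ≢ suc i → count< (topRow (bkRows i A T)) w ≡ count< (topRow T) w
    topRow-suc-≤A : count< (topRow (bkRows i A T)) (suc i) ≤ A

bkRows-result : ∀ i {N} → suc i < N → ∀ A {sh} T → IsSSYT N sh T → count< (topRow T) (suc i) ≤ A →
  BKRowsResult i N A sh T
bkRows-result i 1+i<N A [] [] _ = record { isSSYT = [] ; topRow-≢ = λ _ _ → refl ; topRow-suc-≤A = z≤n }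
bkRows-result i {N} 1+i<N A (r ∷ T) (cons {l} len r↑ T-ssyt r≻T) c₁≤A = record
  { isSSYT        = cons length-r′ (IncRow-rebalance i r x′ r↑ 1+i<N) (BKRowsResult.isSSYT below) r′≻below
  ; topRow-≢      = count<-r′-≢
  ; topRow-suc-≤A = subst (_≤ A) (sym count<-r′-suc) x′≤A }
  where
  open BKRow i A r (topRow T) r≻T c₁≤A
  below = bkRows-result i 1+i<N (count< r i) T T-ssyt (r≻T i)
  length-r′ : length r′ ≡ l
  length-r′ = begin
    length r′    ≡⟨ count<-length r′ (IncRow-rebalance i r x′ r↑ 1+i<N) ⟨
    count< r′ N  ≡⟨ count<-r′-≢ N (<⇒≢ 1+i<N ∘ sym) ⟩
    count< r N   ≡⟨ count<-length r r↑ ⟩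
    length r     ≡⟨ len ⟩
    l            ∎
    where open ≡-Reasoning
  r′≻below : StrictlyBelow r′ (topRow (bkRows i (count< r i) T))
  r′≻below v with v ≟ i
  ... | yes refl = subst (count< (topRow (bkRows i (count< r v) T)) (suc v) ≤_)
                     (sym (count<-r′-≢ v (<⇒≢ (n<1+n v)))) (BKRowsResult.topRow-suc-≤A below)
  ... | no v≢i with v ≟ suc i
  ...   | yes refl = subst₂ _≤_ (sym (BKRowsResult.topRow-≢ below (suc (suc i)) 1+n≢n))
                       (sym count<-r′-suc) s₂≤x′
  ...   | no v≢1+i = subst₂ _≤_ (sym (BKRowsResult.topRow-≢ below (suc v) (v≢i ∘ suc-injective)))
                       (sym (count<-r′-≢ v v≢1+i)) (r≻T v)

benderKnuth-isSSYT : ∀ i {N} → suc i < N → ∀ {sh} T → IsSSYT N sh T → IsSSYT N sh (benderKnuth i T)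
benderKnuth-isSSYT i 1+i<N []      []                    = []
benderKnuth-isSSYT i 1+i<N (r ∷ T) T-ssyt@(cons _ _ _ _) =
  BKRowsResult.isSSYT
    (bkRows-result i 1+i<N (count< r (suc (suc i))) (r ∷ T) T-ssyt (count<-mono r (n≤1+n (suc i))))

bkRows-involutive : ∀ i {N} → suc i < N → ∀ A {sh} T → IsSSYT N sh T → count< (topRow T) (suc i) ≤ A →
  bkRows i A (bkRows i A T) ≡ T
bkRows-involutive i 1+i<N A [] [] _ = refl
bkRows-involutive i 1+i<N A (r ∷ T) (cons _ r↑ T-ssyt r≻T) c₁≤A = cong₂ _∷_ same-row same-rows
  where
  open BKRow i A r (topRow T) r≻T c₁≤A
  T′ = bkRows i (count< r i) T
  c₀′≡c₀ : count< r′ i ≡ count< r i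
  c₀′≡c₀ = count<-r′-≢ i (<⇒≢ (n<1+n i))
  bkCount-r′ : bkCount i A r′ (topRow T′) ≡ count< r (suc i)
  bkCount-r′ = begin
    ((count< r′ i ⊔ count< (topRow T′) (suc (suc i))) + (count< r′ (suc (suc i)) ⊓ A)) ∸ count< r′ (suc i)
      ≡⟨ cong₂ (λ u v → ((u ⊔ v) + (count< r′ (suc (suc i)) ⊓ A)) ∸ count< r′ (suc i)) c₀′≡c₀
           (BKRowsResult.topRow-≢ (bkRows-result i 1+i<N (count< r i) T T-ssyt (r≻T i)) (suc (suc i)) 1+n≢n) ⟩
    (lo + (count< r′ (suc (suc i)) ⊓ A)) ∸ count< r′ (suc i)
      ≡⟨ cong₂ (λ u v → (lo + (u ⊓ A)) ∸ v) (count<-r′-≢ (suc (suc i)) 1+n≢n) count<-r′-suc ⟩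
    (lo + hi) ∸ x′
      ≡⟨ reflect-x′ ⟩
    count< r (suc i)
      ∎
    where open ≡-Reasoning
  same-row : rebalance i r′ (bkCount i A r′ (topRow T′)) ≡ r
  same-row = trans (cong (rebalance i r′) bkCount-r′)
    (trans (rebalance-rebalance i r c₀≤x′ x′≤c₂ (count< r (suc i))) (rebalance-self i r r↑ 1+i<N))
  same-rows : bkRows i (count< r′ i) T′ ≡ T
  same-rows rewrite c₀′≡c₀ = bkRows-involutive i 1+i<N (count< r i) T T-ssyt (r≻T i)

benderKnuth-involutive : ∀ i {N} → suc i < N → ∀ {sh} T → IsSSYT N sh T →
  benderKnuth i (benderKnuth i T) ≡ T
benderKnuth-involutive i 1+i<N []      []                            = refl
benderKnuth-involutive i 1+i<N (r ∷ T) T-ssyt@(cons _ _ _ r≻T) = trans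
  (cong (λ A → bkRows i A (bkRows i (count< r (suc (suc i))) (r ∷ T))) (count<-r′-≢ (suc (suc i)) 1+n≢n))
  (bkRows-involutive i 1+i<N (count< r (suc (suc i))) (r ∷ T) T-ssyt (count<-mono r (n≤1+n (suc i))))
  where open BKRow i (count< r (suc (suc i))) r (topRow T) r≻T (count<-mono r (n≤1+n (suc i)))

-- Content, weight and promotion

tcount< : Tableau → ℕ → ℕ
tcount< []      w = 0
tcount< (r ∷ T) w = count< r w + tcount< T w

tcount<-topRow : ∀ T w → tcount< T w ≡ count< (topRow T) w + tcount< (drop 1 T) w
tcount<-topRow []      w = refl
tcount<-topRow (r ∷ T) w = refl

tcount<-zero : ∀ T → tcount< T 0 ≡ 0
tcount<-zero []      = refl
tcount<-zero (r ∷ T) = trans (cong (_+ tcount< T 0) (count<-zero r)) (tcount<-zero T)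

tcount<-size : ∀ {N sh} T → IsSSYT N sh T → tcount< T N ≡ sum sh
tcount<-size []      []                  = refl
tcount<-size (r ∷ T) (cons len r↑ T-ssyt _) = cong₂ _+_ (trans (count<-length r r↑) len) (tcount<-size T T-ssyt)

+-interchange : ∀ m n o p → (m + n) + (o + p) ≡ (m + o) + (n + p)
+-interchange = solve 4 (λ m n o p → (m :+ n) :+ (o :+ p) := (m :+ o) :+ (n :+ p)) refl

m⊔n+n⊓m≡m+n : ∀ m n → m ⊔ n + n ⊓ m ≡ m + n
m⊔n+n⊓m≡m+n zero    zero    = refl
m⊔n+n⊓m≡m+n zero    (suc n) = +-identityʳ (suc n)
m⊔n+n⊓m≡m+n (suc m) zero    = refl
m⊔n+n⊓m≡m+n (suc m) (suc n) =
  cong suc (trans (+-suc (m ⊔ n) (n ⊓ m)) (trans (cong suc (m⊔n+n⊓m≡m+n m n)) (sym (+-suc m n))))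

bkRows-tcount<-≢ : ∀ i A {N sh} T → IsSSYT N sh T → count< (topRow T) (suc i) ≤ A →
  ∀ w → w ≢ suc i → tcount< (bkRows i A T) w ≡ tcount< T w
bkRows-tcount<-≢ i A []      []                    _    w _        = refl
bkRows-tcount<-≢ i A (r ∷ T) (cons _ _ T-ssyt r≻T) c₁≤A w w≢1+i =
  cong₂ _+_ (count<-r′-≢ w w≢1+i) (bkRows-tcount<-≢ i (count< r i) T T-ssyt (r≻T i) w w≢1+i)
  where open BKRow i A r (topRow T) r≻T c₁≤A

benderKnuth-tcount<-≢ : ∀ i {N sh} T → IsSSYT N sh T → ∀ w → w ≢ suc i →
  tcount< (benderKnuth i T) w ≡ tcount< T w
benderKnuth-tcount<-≢ i []      []                        w _ = refl
benderKnuth-tcount<-≢ i (r ∷ T) T-ssyt@(cons _ _ _ _) w w≢1+i =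
  bkRows-tcount<-≢ i (count< r (suc (suc i))) (r ∷ T) T-ssyt (count<-mono r (n≤1+n (suc i))) w w≢1+i

-- Row by row x′ + x = lo + hi, and the maxima and minima in lo and hi telescope.
bkRows-tcount<-suc : ∀ i A {N sh} T → IsSSYT N sh T → count< (topRow T) (suc i) ≤ A →
  tcount< (bkRows i A T) (suc i) + tcount< T (suc i) ≡
    (count< (topRow T) (suc (suc i)) ⊓ A) + tcount< T i + tcount< (drop 1 T) (suc (suc i))
bkRows-tcount<-suc i A []      []                    _    = refl
bkRows-tcount<-suc i A (r ∷ T) (cons _ _ T-ssyt r≻T) c₁≤A = begin
  (count< r′ (suc i) + S′) + (count< r (suc i) + S)
    ≡⟨ cong (λ y → (y + S′) + (count< r (suc i) + S)) count<-r′-suc ⟩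
  (x′ + S′) + (count< r (suc i) + S)
    ≡⟨ +-interchange x′ S′ (count< r (suc i)) S ⟩
  (x′ + count< r (suc i)) + (S′ + S)
    ≡⟨ cong₂ _+_ x′+x≡lo+hi IH ⟩
  (lo + hi) + ((b ⊓ a + tᵢ) + t₂)
    ≡⟨ regroup₁ lo hi (b ⊓ a) tᵢ t₂ ⟩
  hi + ((lo + b ⊓ a) + (tᵢ + t₂))
    ≡⟨ cong (λ y → hi + (y + (tᵢ + t₂))) (m⊔n+n⊓m≡m+n a b) ⟩
  hi + ((a + b) + (tᵢ + t₂))
    ≡⟨ regroup₂ hi a b tᵢ t₂ ⟩
  (hi + (a + tᵢ)) + (b + t₂)
    ≡⟨ cong ((hi + (a + tᵢ)) +_) (sym (tcount<-topRow T (suc (suc i)))) ⟩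
  (hi + (a + tᵢ)) + tcount< T (suc (suc i))
    ∎
  where
  open ≡-Reasoning
  open BKRow i A r (topRow T) r≻T c₁≤A
  S′ = tcount< (bkRows i (count< r i) T) (suc i)
  S  = tcount< T (suc i)
  a  = count< r i
  b  = count< (topRow T) (suc (suc i))
  tᵢ = tcount< T i
  t₂ = tcount< (drop 1 T) (suc (suc i))
  IH : S′ + S ≡ (b ⊓ a + tᵢ) + t₂
  IH = bkRows-tcount<-suc i (count< r i) T T-ssyt (r≻T i)
  regroup₁ : ∀ p q u v w → (p + q) + ((u + v) + w) ≡ q + ((p + u) + (v + w))
  regroup₁ = solve 5 (λ p q u v w → (p :+ q) :+ ((u :+ v) :+ w) := q :+ ((p :+ u) :+ (v :+ w))) refl
  regroup₂ : ∀ p q u v w → p + ((q + u) + (v + w)) ≡ (p + (q + v)) + (u + w)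
  regroup₂ = solve 5 (λ p q u v w → p :+ ((q :+ u) :+ (v :+ w)) := (p :+ (q :+ v)) :+ (u :+ w)) refl

-- Bender–Knuth exchanges the numbers of entries i and i+1.
benderKnuth-tcount<-suc : ∀ i {N sh} T → IsSSYT N sh T →
  tcount< (benderKnuth i T) (suc i) + tcount< T (suc i) ≡ tcount< T i + tcount< T (suc (suc i))
benderKnuth-tcount<-suc i []      []                        = refl
benderKnuth-tcount<-suc i (r ∷ T) T-ssyt@(cons _ _ _ _) = begin
  tcount< (benderKnuth i (r ∷ T)) (suc i) + tcount< (r ∷ T) (suc i)
    ≡⟨ bkRows-tcount<-suc i c₂ (r ∷ T) T-ssyt (count<-mono r (n≤1+n (suc i))) ⟩
  c₂ ⊓ c₂ + tcount< (r ∷ T) i + tcount< T (suc (suc i))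
    ≡⟨ cong (λ y → y + tcount< (r ∷ T) i + tcount< T (suc (suc i))) (⊓-idem c₂) ⟩
  c₂ + tcount< (r ∷ T) i + tcount< T (suc (suc i))
    ≡⟨ cong (_+ tcount< T (suc (suc i))) (+-comm c₂ (tcount< (r ∷ T) i)) ⟩
  tcount< (r ∷ T) i + c₂ + tcount< T (suc (suc i))
    ≡⟨ +-assoc (tcount< (r ∷ T) i) c₂ _ ⟩
  tcount< (r ∷ T) i + (c₂ + tcount< T (suc (suc i)))
    ∎
  where
  open ≡-Reasoning
  c₂ = count< r (suc (suc i))

sumTo : (ℕ → ℕ) → ℕ → ℕ
sumTo f zero    = 0
sumTo f (suc n) = sumTo f n + f n

sumTo-cong : ∀ {f g} n → (∀ w → w < n → f w ≡ g w) → sumTo f n ≡ sumTo g n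
sumTo-cong zero    f≡g = refl
sumTo-cong (suc n) f≡g = cong₂ _+_ (sumTo-cong n (λ w w<n → f≡g w (m<n⇒m<1+n w<n))) (f≡g n ≤-refl)

sumTo-+ : ∀ f g n → sumTo (λ w → f w + g w) n ≡ sumTo f n + sumTo g n
sumTo-+ f g zero    = refl
sumTo-+ f g (suc n) =
  trans (cong (_+ (f n + g n)) (sumTo-+ f g n)) (+-interchange (sumTo f n) (sumTo g n) (f n) (g n))

sumTo-zero : ∀ n → sumTo (λ _ → 0) n ≡ 0
sumTo-zero zero    = refl
sumTo-zero (suc n) = trans (+-identityʳ _) (sumTo-zero n)

sumTo-suc : ∀ f n → sumTo f (suc n) ≡ f 0 + sumTo (f ∘ suc) n
sumTo-suc f zero    = +-comm 0 (f 0)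
sumTo-suc f (suc n) = trans (cong (_+ f (suc n)) (sumTo-suc f n)) (+-assoc (f 0) (sumTo (f ∘ suc) n) (f (suc n)))

sumTo-+-const : ∀ f c n → sumTo (λ w → f w + c) n ≡ sumTo f n + n * c
sumTo-+-const f c n = trans (sumTo-+ f (λ _ → c) n) (cong (sumTo f n +_) (sumTo-const n))
  where
  sumTo-const : ∀ n → sumTo (λ _ → c) n ≡ n * c
  sumTo-const zero    = refl
  sumTo-const (suc n) = trans (cong (_+ c) (sumTo-const n)) (+-comm (n * c) c)

-- An entry e < N is counted by count< _ (suc w) for exactly the N ∸ e values w ∈ [e, N).
entry+count : ∀ e N → e < N → e + sumTo (λ w → count< (e ∷ []) (suc w)) N ≡ N
entry+count e zero    ()
entry+count e (suc N) e<1+N with e ≟ N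
... | yes refl = begin
  e + (sumTo (λ w → count< (e ∷ []) (suc w)) e + count< (e ∷ []) (suc e))
    ≡⟨ cong₂ (λ x y → e + (x + y)) (trans (sumTo-cong e (λ w w<e → count<-∷-≥ [] w<e)) (sumTo-zero e))
                                    (count<-∷-< {e} [] ≤-refl) ⟩
  e + 1
    ≡⟨ +-comm e 1 ⟩
  suc e
    ∎
  where open ≡-Reasoning
... | no e≢N = begin
  e + (sumTo (λ w → count< (e ∷ []) (suc w)) N + count< (e ∷ []) (suc N))
    ≡⟨ cong (λ y → e + (sumTo (λ w → count< (e ∷ []) (suc w)) N + y)) (count<-∷-< {e} [] e<1+N) ⟩
  e + (sumTo (λ w → count< (e ∷ []) (suc w)) N + 1)
    ≡⟨ +-assoc e _ 1 ⟨
  (e + sumTo (λ w → count< (e ∷ []) (suc w)) N) + 1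
    ≡⟨ cong (_+ 1) (entry+count e N (≤∧≢⇒< (≤-pred e<1+N) e≢N)) ⟩
  N + 1
    ≡⟨ +-comm N 1 ⟩
  suc N
    ∎
  where open ≡-Reasoning

row-sum+counts : ∀ {lo N} r → IncRow lo N r → sum r + sumTo (λ w → count< r (suc w)) N ≡ N * length r
row-sum+counts {N = N} [] inc[] = trans (sumTo-zero N) (sym (*-zeroʳ N))
row-sum+counts {N = N} (e ∷ r) (inc∷ _ e<N r↑) = begin
  (e + sum r) + sumTo (λ w → count< (e ∷ r) (suc w)) N
    ≡⟨ cong ((e + sum r) +_) (trans (sumTo-cong N (λ w _ → count<-++ (e ∷ []) r (suc w))) (sumTo-+ _ _ N)) ⟩
  (e + sum r) + (sumTo (λ w → count< (e ∷ []) (suc w)) N + sumTo (λ w → count< r (suc w)) N)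
    ≡⟨ +-interchange e (sum r) _ _ ⟩
  (e + sumTo (λ w → count< (e ∷ []) (suc w)) N) + (sum r + sumTo (λ w → count< r (suc w)) N)
    ≡⟨ cong₂ _+_ (entry+count e N e<N) (row-sum+counts r r↑) ⟩
  N + N * length r
    ≡⟨ *-suc N (length r) ⟨
  N * suc (length r)
    ∎
  where open ≡-Reasoning

weight+counts : ∀ {N sh} T → IsSSYT N sh T → weight T + sumTo (λ w → tcount< T (suc w)) N ≡ N * sum sh
weight+counts {N} [] [] = trans (sumTo-zero N) (sym (*-zeroʳ N))
weight+counts {N} {l ∷ sh} (r ∷ T) (cons len r↑ T-ssyt _) = begin
  (sum r + weight T) + sumTo (λ w → count< r (suc w) + tcount< T (suc w)) N
    ≡⟨ cong ((sum r + weight T) +_) (sumTo-+ _ _ N) ⟩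
  (sum r + weight T) + (sumTo (λ w → count< r (suc w)) N + sumTo (λ w → tcount< T (suc w)) N)
    ≡⟨ +-interchange (sum r) (weight T) _ _ ⟩
  (sum r + sumTo (λ w → count< r (suc w)) N) + (weight T + sumTo (λ w → tcount< T (suc w)) N)
    ≡⟨ cong₂ _+_ (row-sum+counts r r↑) (weight+counts T T-ssyt) ⟩
  N * length r + N * sum sh
    ≡⟨ cong (λ y → N * y + N * sum sh) len ⟩
  N * l + N * sum sh
    ≡⟨ *-distribˡ-+ N l (sum sh) ⟨
  N * (l + sum sh)
    ∎
  where open ≡-Reasoning

bkChain : ℕ → Tableau → Tableau
bkChain zero    T = T
bkChain (suc j) T = benderKnuth j (bkChain j T)

-- BK_(j-1) ∘ ⋯ ∘ BK_0 rotates the multiplicities (c₀, c₁, …, c_j) of the values 0, …, j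
-- to (c₁, …, c_j, c₀).
record BKChainInvariant (N : ℕ) (sh : List ℕ) (T : Tableau) (j : ℕ) : Set where
  field
    isSSYT    : IsSSYT N sh (bkChain j T)
    tcount<-> : ∀ w → j < w → tcount< (bkChain j T) w ≡ tcount< T w
    tcount<-< : ∀ w → w < j → tcount< (bkChain j T) (suc w) + tcount< T 1 ≡ tcount< T (suc (suc w))

bkChain-invariant : ∀ {N sh} T → IsSSYT N sh T → ∀ j → j < N → BKChainInvariant N sh T j
bkChain-invariant T T-ssyt zero _ = record { isSSYT = T-ssyt ; tcount<-> = λ _ _ → refl ; tcount<-< = λ _ () }
bkChain-invariant T T-ssyt (suc j) 1+j<N = record
  { isSSYT    = benderKnuth-isSSYT j 1+j<N C C-ssyt
  ; tcount<-> = λ w 1+j<w → trans (benderKnuth-tcount<-≢ j C C-ssyt w (<⇒≢ 1+j<w ∘ sym))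
                                  (tcount<-> w (<-trans (n<1+n j) 1+j<w))
  ; tcount<-< = tcount<-<′ }
  where
  open BKChainInvariant (bkChain-invariant T T-ssyt j (<-trans (n<1+n j) 1+j<N))
  C      = bkChain j T
  C-ssyt = isSSYT
  X      = tcount< (benderKnuth j C) (suc j)
  exchange : X + tcount< T (suc j) ≡ tcount< C j + tcount< T (suc (suc j))
  exchange = subst₂ (λ u v → X + u ≡ tcount< C j + v)
    (tcount<-> (suc j) (n<1+n j)) (tcount<-> (suc (suc j)) (m<n+m j z<s)) (benderKnuth-tcount<-suc j C C-ssyt)
  last : ∀ j → (∀ w → w < j → tcount< C (suc w) + tcount< T 1 ≡ tcount< T (suc (suc w))) →
    X + tcount< T (suc j) ≡ tcount< C j + tcount< T (suc (suc j)) → X + tcount< T 1 ≡ tcount< T (suc (suc j))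
  last zero     _     exch = trans exch (cong (_+ tcount< T 2) (tcount<-zero C))
  last (suc j′) below exch = +-cancelʳ-≡ (tcount< C (suc j′)) _ _ (begin
    (X + tcount< T 1) + tcount< C (suc j′)  ≡⟨ +-assoc X (tcount< T 1) _ ⟩
    X + (tcount< T 1 + tcount< C (suc j′))
      ≡⟨ cong (X +_) (trans (+-comm (tcount< T 1) _) (below j′ (n<1+n j′))) ⟩
    X + tcount< T (suc (suc j′))            ≡⟨ exch ⟩
    tcount< C (suc j′) + tcount< T (suc (suc (suc j′))) ≡⟨ +-comm (tcount< C (suc j′)) _ ⟩
    tcount< T (suc (suc (suc j′))) + tcount< C (suc j′) ∎)
    where open ≡-Reasoning
  tcount<-<′ : ∀ w → w < suc j → tcount< (benderKnuth j C) (suc w) + tcount< T 1 ≡ tcount< T (suc (suc w))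
  tcount<-<′ w w<1+j with w ≟ j
  ... | yes refl = last w tcount<-< exchange
  ... | no  w≢j  = trans
    (cong (_+ tcount< T 1) (benderKnuth-tcount<-≢ j C C-ssyt (suc w) (w≢j ∘ suc-injective)))
                         (tcount<-< w (≤∧≢⇒< (≤-pred w<1+j) w≢j))

-- The full chain is promotion: it rotates the content, so the weight drops by |sh| and
-- gains N for every entry 0.
bkChain-weight : ∀ M {sh} T → IsSSYT (suc M) sh T →
  IsSSYT (suc M) sh (bkChain M T) × (weight T + tcount< T 1 * suc M ≡ weight (bkChain M T) + sum sh)
bkChain-weight M {sh} T T-ssyt = isSSYT , +-cancelʳ-≡ Sσ _ _ (begin
  (weight T + c * suc M) + Sσ
    ≡⟨ regroup (weight T) c Sσ M ⟩
  weight T + (c + (Sσ + M * c))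
    ≡⟨ cong (λ y → weight T + (c + y)) (sumTo-+-const (λ w → tcount< S (suc w)) c M) ⟨
  weight T + (c + sumTo (λ w → tcount< S (suc w) + c) M)
    ≡⟨ cong (λ y → weight T + (c + y)) (sumTo-cong M tcount<-<) ⟩
  weight T + (c + sumTo (λ w → tcount< T (suc (suc w))) M)
    ≡⟨ cong (weight T +_) (sumTo-suc (λ w → tcount< T (suc w)) M) ⟨
  weight T + sumTo (λ w → tcount< T (suc w)) (suc M)
    ≡⟨ weight+counts T T-ssyt ⟩
  suc M * sum sh
    ≡⟨ weight+counts S isSSYT ⟨
  weight S + (Sσ + tcount< S (suc M))
    ≡⟨ cong (λ y → weight S + (Sσ + y)) (tcount<-size S isSSYT) ⟩
  weight S + (Sσ + sum sh)
    ≡⟨ cong (weight S +_) (+-comm Sσ (sum sh)) ⟩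
  weight S + (sum sh + Sσ)
    ≡⟨ +-assoc (weight S) (sum sh) Sσ ⟨
  (weight S + sum sh) + Sσ
    ∎)
  where
  open ≡-Reasoning
  open BKChainInvariant (bkChain-invariant T T-ssyt M (n<1+n M))
  S  = bkChain M T
  c  = tcount< T 1
  Sσ = sumTo (λ w → tcount< S (suc w)) M
  regroup : ∀ a c s m → (a + c * suc m) + s ≡ a + (c + (s + m * c))
  regroup = solve 4 (λ a c s m → (a :+ c :* (con 1 :+ m)) :+ s := a :+ (c :+ (s :+ m :* c))) refl

-- The enumeration ssyt

strictlyBelow⇒StrictlyBelow : ∀ {lo lo′ N} r s → IncRow lo N r → IncRow lo′ N s →
  T (strictlyBelow r s) → StrictlyBelow r s
strictlyBelow⇒StrictlyBelow r       []      _ _ _ v = z≤n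
strictlyBelow⇒StrictlyBelow (a ∷ r) (b ∷ s) (inc∷ _ _ r↑) (inc∷ _ _ s↑) a<b∧r≻s v with b ≤? v
... | yes b≤v rewrite count<-∷-< {b} {suc v} s (s≤s b≤v)
                    | count<-∷-< {a} {v} r (<-≤-trans (<ᵇ⇒< a b (proj₁ (Equivalence.to T-∧ a<b∧r≻s))) b≤v) =
  s≤s (strictlyBelow⇒StrictlyBelow r s r↑ s↑ (proj₂ (Equivalence.to T-∧ a<b∧r≻s)) v)
... | no  b≰v rewrite count<-∷-≥ {b} {suc v} s (≰⇒> b≰v)
                    | count<-none s (All.map (≤-trans (≰⇒> b≰v)) (IncRow⇒All≥ s↑)) = z≤n

StrictlyBelow⇒strictlyBelow : ∀ {lo lo′ N} r s → IncRow lo N r → IncRow lo′ N s →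
  StrictlyBelow r s → T (strictlyBelow r s)
StrictlyBelow⇒strictlyBelow r       []      _ _ _ = _
StrictlyBelow⇒strictlyBelow []      (b ∷ s) _ _ r≻s =
  contradiction (subst (_≤ 0) (count<-∷-< {b} s ≤-refl) (r≻s b)) λ ()
StrictlyBelow⇒strictlyBelow (a ∷ r) (b ∷ s) (inc∷ _ _ r↑) (inc∷ _ _ s↑) r≻s =
  Equivalence.from T-∧ (<⇒<ᵇ a<b , StrictlyBelow⇒strictlyBelow r s r↑ s↑ tails)
  where
  a<b : a < b
  a<b with a <? b
  ... | yes a<b = a<b
  ... | no  a≮b = contradiction (subst₂ _≤_ (count<-∷-< {b} s ≤-refl)
          (trans (count<-∷-≥ r (≮⇒≥ a≮b)) (count<-none r (All.map (≤-trans (≮⇒≥ a≮b)) (IncRow⇒All≥ r↑))))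
          (r≻s b)) λ ()
  tails : StrictlyBelow r s
  tails v with b <? suc v
  ... | yes b<1+v =
    ≤-pred (≤-trans (subst (_≤ count< (a ∷ r) v) (count<-∷-< s b<1+v) (r≻s v)) (count<-∷-≤ a r v))
  ... | no  b≮1+v rewrite count<-none s (All.map (≤-trans (≮⇒≥ b≮1+v)) (IncRow⇒All≥ s↑)) = z≤n

consAll : {A : Set} → (A → List (List A)) → List A → List (List A)
consAll g = concatMap (λ a → map (a ∷_) (g a))

∈-consAll⁻ : ∀ {A : Set} (g : A → List (List A)) xs {ys} → ys ∈ consAll g xs →
  ∃₂ λ a ys′ → ys ≡ a ∷ ys′ × a ∈ xs × ys′ ∈ g a
∈-consAll⁻ g (x ∷ xs) ys∈ with ∈-++⁻ (map (x ∷_) (g x)) ys∈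
... | inj₁ ys∈x∷g with ∈-map⁻ (x ∷_) ys∈x∷g
...   | ys′ , ys′∈g , refl = x , ys′ , refl , here refl , ys′∈g
∈-consAll⁻ g (x ∷ xs) ys∈ | inj₂ ys∈rest with ∈-consAll⁻ g xs ys∈rest
... | a , ys′ , eq , a∈xs , ys′∈g = a , ys′ , eq , there a∈xs , ys′∈g

∈-consAll⁺ : ∀ {A : Set} (g : A → List (List A)) xs {a ys′} → a ∈ xs → ys′ ∈ g a → a ∷ ys′ ∈ consAll g xs
∈-consAll⁺ g (x ∷ xs) (here refl) ys′∈g = ∈-++⁺ˡ (∈-map⁺ (x ∷_) ys′∈g)
∈-consAll⁺ g (x ∷ xs) (there a∈xs) ys′∈g = ∈-++⁺ʳ (map (x ∷_) (g x)) (∈-consAll⁺ g xs a∈xs ys′∈g)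

consAll-unique : ∀ {A : Set} (g : A → List (List A)) xs → Unique xs → (∀ a → Unique (g a)) →
  Unique (consAll g xs)
consAll-unique g []       _              _  = []
consAll-unique g (x ∷ xs) (x∉xs ∷ xs!) g! =
  Unique.++⁺ (Unique.map⁺ ∷-injectiveʳ (g! x)) (consAll-unique g xs xs! g!) disjoint
  where
  ∷-injectiveʳ : ∀ {ys zs : List _} → x ∷ ys ≡ x ∷ zs → ys ≡ zs
  ∷-injectiveʳ refl = refl
  disjoint : ∀ {v} → ¬ (v ∈ map (x ∷_) (g x) × v ∈ consAll g xs)
  disjoint (v∈x∷g , v∈rest) with ∈-map⁻ (x ∷_) v∈x∷g | ∈-consAll⁻ g xs v∈rest
  ... | _ , _ , refl | a , _ , refl , a∈xs , _ = All.lookup x∉xs a∈xs refl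

∈-range⁻ : ∀ {lo N a} → a ∈ range lo N → lo ≤ a × a < N
∈-range⁻ {lo} {N} a∈ with ∈-map⁻ (lo +_) a∈
... | k , k∈ , refl = m≤m+n lo k , subst (lo + k <_) (m+[n∸m]≡n lo≤N) (+-monoʳ-< lo (∈-upTo⁻ k∈))
  where
  lo≤N : lo ≤ N
  lo≤N = <⇒≤ (m∸n≢0⇒n<m (λ N∸lo≡0 → n≮0 (subst (k <_) N∸lo≡0 (∈-upTo⁻ k∈))))

∈-range⁺ : ∀ {lo N a} → lo ≤ a → a < N → a ∈ range lo N
∈-range⁺ {lo} {N} lo≤a a<N =
  subst (_∈ range lo N) (m+[n∸m]≡n lo≤a) (∈-map⁺ (lo +_) (∈-upTo⁺ (∸-monoˡ-< a<N lo≤a)))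

range-unique : ∀ lo N → Unique (range lo N)
range-unique lo N = Unique.map⁺ (+-cancelˡ-≡ lo _ _) (Unique.upTo⁺ (N ∸ lo))

∈-incRows⁻ : ∀ N l lo {r} → r ∈ incRows N l lo → length r ≡ l × IncRow lo N r
∈-incRows⁻ N zero    lo (here refl) = refl , inc[]
∈-incRows⁻ N (suc l) lo r∈ with ∈-consAll⁻ (incRows N l) (range lo N) r∈
... | a , r′ , refl , a∈ , r′∈ with ∈-incRows⁻ N l a r′∈ | ∈-range⁻ a∈
... | len , r′↑ | lo≤a , a<N = cong suc len , inc∷ lo≤a a<N r′↑

∈-incRows⁺ : ∀ N l lo {r} → length r ≡ l → IncRow lo N r → r ∈ incRows N l lo
∈-incRows⁺ N zero    lo {[]}    refl inc[] = here refl
∈-incRows⁺ N (suc l) lo {a ∷ r} len  (inc∷ lo≤a a<N r↑) =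
  ∈-consAll⁺ (incRows N l) (range lo N) (∈-range⁺ lo≤a a<N) (∈-incRows⁺ N l a (suc-injective len) r↑)

incRows-unique : ∀ N l lo → Unique (incRows N l lo)
incRows-unique N zero    lo = [] ∷ []
incRows-unique N (suc l) lo = consAll-unique (incRows N l) (range lo N) (range-unique lo N) (incRows-unique N l)

ssyt-unique : ∀ N sh → Unique (ssyt N sh)
ssyt-unique N []       = [] ∷ []
ssyt-unique N (l ∷ sh) =
  consAll-unique (λ r → filterᵇ (compatible r) (ssyt N sh)) (incRows N l 0) (incRows-unique N l 0)
  (λ r → Unique.filter⁺ (T? ∘ compatible r) (ssyt-unique N sh))

∈-ssyt⁻ : ∀ N sh {T} → T ∈ ssyt N sh → IsSSYT N sh T
∈-ssyt⁻ N []       (here refl) = []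
∈-ssyt⁻ N (l ∷ sh) T∈ with ∈-consAll⁻ (λ r → filterᵇ (compatible r) (ssyt N sh)) (incRows N l 0) T∈
... | r , T′ , refl , r∈ , T′∈ with ∈-filter⁻ (T? ∘ compatible r) T′∈ | ∈-incRows⁻ N l 0 r∈
... | T′∈ssyt , r≻T′ | len , r↑ = cons len r↑ T′-ssyt (below T′ T′-ssyt r≻T′)
  where
  T′-ssyt = ∈-ssyt⁻ N sh T′∈ssyt
  below : ∀ T′ → IsSSYT N sh T′ → T (compatible r T′) → StrictlyBelow r (topRow T′)
  below []      _                 _    v = z≤n
  below (s ∷ _) (cons _ s↑ _ _) r≻s = strictlyBelow⇒StrictlyBelow r s r↑ s↑ r≻s

∈-ssyt⁺ : ∀ N sh {T} → IsSSYT N sh T → T ∈ ssyt N sh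
∈-ssyt⁺ N []       []                                  = here refl
∈-ssyt⁺ N (l ∷ sh) (cons {r = r} {T = T′} len r↑ T′-ssyt r≻T′) =
  ∈-consAll⁺ (λ r → filterᵇ (compatible r) (ssyt N sh)) (incRows N l 0) (∈-incRows⁺ N l 0 len r↑)
    (∈-filter⁺ (T? ∘ compatible r) (∈-ssyt⁺ N sh T′-ssyt) (compatible-r T′ T′-ssyt r≻T′))
  where
  compatible-r : ∀ T′ → IsSSYT N sh T′ → StrictlyBelow r (topRow T′) → T (compatible r T′)
  compatible-r []      _                 _   = _
  compatible-r (s ∷ _) (cons _ s↑ _ _) r≻s = StrictlyBelow⇒strictlyBelow r s r↑ s↑ r≻s

coprime⇒inverse : ∀ m n → 1 ≤ m → 1 ≤ n → Coprime m n → ∃₂ λ u t → u * n ≡ 1 + t * m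
coprime⇒inverse m n _ _ m⊥n with coprime-Bézout m⊥n
... | Bézout.-+ x y 1+xm≡yn = y , x , sym 1+xm≡yn
coprime⇒inverse 1 (suc n′) _ _ _ | Bézout.+- _ _ _ = 1 , n′ , cong suc (trans (+-identityʳ n′) (sym (*-identityʳ n′)))
coprime⇒inverse (suc (suc m″)) n _ _ _ | Bézout.+- zero y ()
coprime⇒inverse (suc (suc m″)) n _ _ _ | Bézout.+- (suc x′) y 1+yn≡xm =
  y * suc m″ , x′ + m″ * suc x′ , +-cancelˡ-≡ (suc m″) _ _ (begin
    suc m″ + y * suc m″ * n
      ≡⟨ solve 3 (λ m y n → m :+ y :* m :* n := m :* (con 1 :+ y :* n)) refl (suc m″) y n ⟩
    suc m″ * (1 + y * n)
      ≡⟨ cong (suc m″ *_) 1+yn≡xm ⟩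
    suc m″ * (suc x′ * suc (suc m″))
      ≡⟨ solve 2 (λ m x → (con 1 :+ m) :* ((con 1 :+ x) :* (con 2 :+ m))
                          := (con 1 :+ m) :+ (con 1 :+ (x :+ m :* (con 1 :+ x)) :* (con 2 :+ m))) refl m″ x′ ⟩
    suc m″ + (1 + (x′ + m″ * suc x′) * suc (suc m″))
      ∎)
  where open ≡-Reasoning

scale-inverse : ∀ k m n u t → u * n ≡ 1 + t * m → u * (k * n) ≡ k + t * (k * m)
scale-inverse k m n u t un≡1+tm = begin
  u * (k * n)      ≡⟨ solve 3 (λ u k n → u :* (k :* n) := k :* (u :* n)) refl u k n ⟩
  k * (u * n)      ≡⟨ cong (k *_) un≡1+tm ⟩
  k * (1 + t * m)  ≡⟨ solve 3 (λ k t m → k :* (con 1 :+ t :* m) := k :+ t :* (k :* m)) refl k t m ⟩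
  k + t * (k * m)  ∎
  where open ≡-Reasoning

sumₚ-∘-bkChain : ∀ M sh (f : Tableau → Poly) j → j ≤ M →
  sumₚ (f ∘ bkChain j) (ssyt (suc M) sh) ≋ sumₚ f (ssyt (suc M) sh)
sumₚ-∘-bkChain M sh f zero    _     = ≋-refl
sumₚ-∘-bkChain M sh f (suc j) 1+j≤M =
  ≋-trans (sumₚ-∘-bkChain M sh (f ∘ benderKnuth j) j (≤-trans (n≤1+n j) 1+j≤M))
  (sumₚ-∘-involution (List.≡-dec (List.≡-dec _≟_)) (ssyt-unique (suc M) sh) (benderKnuth j)
    (∈-ssyt⁺ (suc M) sh ∘ benderKnuth-isSSYT j (s≤s 1+j≤M) _ ∘ ∈-ssyt⁻ (suc M) sh)
    (λ {T} → benderKnuth-involutive j (s≤s 1+j≤M) T ∘ ∈-ssyt⁻ (suc M) sh) f)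

qint-∣ₚ-qint-*-schurPS : ∀ M sh k u t → u * sum sh ≡ k + t * suc M →
  qint (suc M) ∣ₚ qint k *ₚ schurPS (suc M) sh
qint-∣ₚ-qint-*-schurPS M sh k u t u|sh|≡k+tN =
  qint-∣ₚ-qint-*-sumₚ-monomial SSYT weight (suc M) (sum sh) k u t u|sh|≡k+tN
    (qint-∣ₚ-sumₚ-shift-qint SSYT weight (weight ∘ bkChain M) (λ T → tcount< T 1) (suc M) (sum sh)
      (proj₂ ∘ bkChain-weight M _ ∘ ∈-ssyt⁻ (suc M) sh)
      (λ h → sumₚ-∘-bkChain M sh (h ∘ weight) M ≤-refl))
  where SSYT = ssyt (suc M) sh

proposition2p2 : (m n k : ℕ) → 1 ≤ m → 1 ≤ n → 1 ≤ k → Coprime m n →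
    (λ′ : List ℕ) → IsPartition λ′ → sum λ′ ≡ k * n →
    ∃ λ (P : Poly) → (qint (k * m) *ₚ P) ≈ₚ (qint k *ₚ schurPS (k * m) λ′)
-- The argument never uses that λ′ is a partition. Note that k * m reduces to suc (m′ + k′ * m).
proposition2p2 m@(suc m′) n k@(suc k′) 1≤m 1≤n _ m⊥n λ′ _ |λ′|≡kn
  with u , t , un≡1+tm ← coprime⇒inverse m n 1≤m 1≤n m⊥n = quotient , coeff-≡ equality
  where
  open _∣ₚ_ (qint-∣ₚ-qint-*-schurPS (m′ + k′ * m) λ′ k u t
               (trans (cong (u *_) |λ′|≡kn) (scale-inverse k m n u t un≡1+tm)))
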